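{- Let $n\ge 2$, $1\le h(1)\le n$, and let $R=\mathbb{C}[x_1,\ldots,x_n,y_1,\ldots,y_n]/I$, where $I$ is generated by: $y_ky_{k'}$ ($k\ne k'$); $x_1y_k$ ($1\le k\le n$); $\left(\prod_{\ell=h(1)+1}^n(-x_\ell)\right)y_k-\prod_{\ell=2}^n(-x_\ell)$ ($1\le k\le n$); $\sum_{k=1}^ny_k-\prod_{\ell=2}^{h(1)}(x_1-x_\ell)$; and $e_i(x_1,\ldots,x_n)$ ($1\le i\le n$), empty products being $1$. Suppose $0\le\ell_j\le n-1-j$ for $1\le j\le n-1$ and that the monomial $x_n^{\ell_1}x_{n-1}^{\ell_2}\cdots x_2^{\ell_{n-1}}$ is not divisible by $\prod_{\ell=h(1)+1}^nx_\ell$. Then the $n$ elements $x_n^{\ell_1}x_{n-1}^{\ell_2}\cdots x_2^{\ell_{n-1}}y_k$, $1\le k\le n$, are linearly independent over $\mathbb{C}$ in $R$.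
   Context: $R\cong H^*(\mathrm{Hess}(S,h);\mathbb{C})$ for $h=(h(1),n,\ldots,n)$ and $S$ regular semisimple (Abe–Horiguchi–Masuda). -}

module Defs where

open import Level using (_⊔_)
open import Algebra.Bundles using (CommutativeRing)
open import Data.Nat as ℕ using (ℕ; zero; suc; _≤_; _∸_; _<?_; _≤?_)
open import Data.Nat.Properties as ℕP using ()
open import Data.Fin as Fin using (Fin; toℕ; fromℕ<)
open import Data.Fin.Properties as FinP using ()
open import Data.Vec as Vec using (Vec; []; _∷_; replicate; zipWith; updateAt; tabulate)
open import Data.Vec.Properties as VecP using ()
open import Data.List as List using (List; []; _∷_; _++_; map; concatMap; allFin; filter; foldr; length)
open import Data.Product using (Σ; ∃; _×_; _,_; proj₁; proj₂)
open import Data.Product.Properties using (≡-dec)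
open import Relation.Nullary using (¬_; yes; no; Dec)
open import Relation.Nullary.Decidable using (_×-dec_)
open import Relation.Binary.PropositionalEquality using (_≡_; _≢_)

module _ {c ℓ} (K : CommutativeRing c ℓ) where
  open CommutativeRing K

  pow : Carrier → ℕ → Carrier
  pow a zero    = 1#
  pow a (suc k) = a * pow a k

  natK : ℕ → Carrier
  natK zero    = 0#
  natK (suc k) = 1# + natK k

  IsField : Set (c ⊔ ℓ)
  IsField = (¬ (1# ≈ 0#)) × (∀ a → ¬ (a ≈ 0#) → ∃ λ b → a * b ≈ 1#)

  CharZero : Set ℓ
  CharZero = ∀ k → ¬ (natK (suc k) ≈ 0#)

  AlgClosed : Set (c ⊔ ℓ)
  AlgClosed = ∀ d (a : Fin (suc d) → Carrier) →
    ∃ λ r → pow r (suc d) + List.foldr _+_ 0# (List.map (λ i → a i * pow r (toℕ i)) (allFin (suc d))) ≈ 0#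

-- a monomial: exponent vector of the x's and of the y's (position i ↔ variable index i+1)
Mon : ℕ → Set
Mon n = Vec ℕ n × Vec ℕ n

_≟M_ : ∀ {n} (m m' : Mon n) → Dec (m ≡ m')
_≟M_ = ≡-dec (VecP.≡-dec ℕP._≟_) (VecP.≡-dec ℕP._≟_)

module Poly {c ℓ} (K : CommutativeRing c ℓ) (n : ℕ) where
  open CommutativeRing K

  P : Set c
  P = List (Carrier × Mon n)

  sumK : List Carrier → Carrier
  sumK = foldr _+_ 0#

  coeff : P → Mon n → Carrier
  coeff p m = sumK (map (λ t → cf t m) p)
    where
    cf : Carrier × Mon n → Mon n → Carrier
    cf (a , m') m with m' ≟M m
    ... | yes _ = a
    ... | no  _ = 0#

  _≃_ : P → P → Set ℓ
  p ≃ q = ∀ m → coeff p m ≈ coeff q m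

  one-mon : Mon n
  one-mon = replicate n 0 , replicate n 0

  mulMon : Mon n → Mon n → Mon n
  mulMon (a , b) (a' , b') = zipWith ℕ._+_ a a' , zipWith ℕ._+_ b b'

  0p : P
  0p = []

  const : Carrier → P
  const a = (a , one-mon) ∷ []

  1p : P
  1p = const 1#

  _⊕_ : P → P → P
  _⊕_ = _++_

  ⊖_ : P → P
  ⊖ p = map (λ { (a , m) → (- a , m) }) p

  _⊝_ : P → P → P
  p ⊝ q = p ⊕ (⊖ q)

  _⊛_ : P → P → P
  p ⊛ q = concatMap (λ { (a , m) → map (λ { (b , m') → (a * b , mulMon m m') }) q }) p

  _^P_ : P → ℕ → P
  p ^P zero    = 1p
  p ^P (suc k) = p ⊛ (p ^P k)

  ΣP : List P → P
  ΣP = foldr _⊕_ 0p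

  ΠP : List P → P
  ΠP = foldr _⊛_ 1p

  -- variables, 0-based Fin index i ↔ x_{i+1}, y_{i+1}
  x : Fin n → P
  x i = (1# , (updateAt (replicate n 0) i suc , replicate n 0)) ∷ []

  y : Fin n → P
  y i = (1# , (replicate n 0 , updateAt (replicate n 0) i suc)) ∷ []

  -- x_m for a 1-based index m with 1 ≤ m ≤ n (only ever used in that range; 0 otherwise)
  X : ℕ → P
  X zero = 0p
  X (suc m) with m <? n
  ... | yes m<n = x (fromℕ< m<n)
  ... | no  _   = 0p

  -- the variable indices ℓ (as Fin n, 0-based) with a ≤ ℓ ≤ b in 1-based numbering
  range : ℕ → ℕ → List (Fin n)
  range a b = filter (λ i → (a ≤? suc (toℕ i)) ×-dec (suc (toℕ i) ≤? b)) (allFin n)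

  ΠRange : ℕ → ℕ → (Fin n → P) → P
  ΠRange a b f = ΠP (map f (range a b))

  sublists : ∀ {a} {A : Set a} → List A → List (List A)
  sublists []       = [] ∷ []
  sublists (z ∷ zs) = let s = sublists zs in map (z ∷_) s ++ s

  esym : ℕ → P
  esym i = ΣP (map (λ S → ΠP (map x S)) (filter (λ S → length S ℕ.≟ i) (sublists (allFin n))))

  _∣P_ : P → P → Set (c ⊔ ℓ)
  a ∣P b = ∃ λ q → b ≃ (q ⊛ a)

  data Gen : Set where
    gyy  : (k k' : Fin n) → k ≢ k' → Gen
    gxy  : (k : Fin n) → Gen
    grel : (k : Fin n) → Gen
    gsum : Gen
    gel  : (i : Fin n) → Gen

  gen : ℕ → Gen → P
  gen h₁ (gyy k k' _) = y k ⊛ y k'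
  gen h₁ (gxy k)      = X 1 ⊛ y k
  gen h₁ (grel k)     = (ΠRange (suc h₁) n (λ l → ⊖ x l) ⊛ y k) ⊝ ΠRange 2 n (λ l → ⊖ x l)
  gen h₁ gsum         = ΣP (map y (allFin n)) ⊝ ΠRange 2 h₁ (λ l → X 1 ⊝ x l)
  gen h₁ (gel i)      = esym (suc (toℕ i))

  InI : ℕ → P → Set (c ⊔ ℓ)
  InI h₁ f = ∃ λ (ts : List (P × Gen)) → f ≃ ΣP (map (λ { (q , g) → q ⊛ gen h₁ g }) ts)

  -- the monomial x_n^{l_1} x_{n-1}^{l_2} ⋯ x_2^{l_{n-1}}, with l_j = l (j-1) for j = 1..n-1
  monoL : (Fin (n ∸ 1) → ℕ) → P
  monoL l = ΠP (map (λ j → X (n ∸ toℕ j) ^P l j) (allFin (n ∸ 1)))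

  tailX : ℕ → P
  tailX h₁ = ΠRange (suc h₁) n x

  linComb : (Fin n → Carrier) → (Fin n → P) → P
  linComb a v = ΣP (map (λ k → const (a k) ⊛ v k) (allFin n))

  LinIndepInR : ℕ → (Fin n → P) → Set (c ⊔ ℓ)
  LinIndepInR h₁ v = ∀ (a : Fin n → Carrier) → InI h₁ (linComb a v) → ∀ k → a k ≈ 0#

{-# OPTIONS --safe #-}
module Submission where

-- Write x^L for the given monomial and z = (x₂, …, xₙ). For each k we build a K-linear functional
-- Φ on K[x, y] that vanishes on I and on x^L y_j for j ≠ k and takes a value ±1 on x^L y_k;
-- applied to a relation ∑ a_j x^L y_j ∈ I it yields a_k = 0. Φ substitutes x₁ ↦ 0, y_j ↦ 0 (j ≠ k)
-- and y_k ↦ ∏_{ℓ=2}^{h(1)} (-x_ℓ), multiplies by a monomial z^g, and pairs the result with the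
-- Vandermonde polynomial Δ = ∏_{i<j} (zᵢ - zⱼ) coefficientwise. The substitution kills y_j y_j′,
-- x₁ y_j and ∑_j y_j - ∏ (x₁ - x_ℓ); it turns (∏_{ℓ>h(1)} (-x_ℓ)) y_j - ∏_{ℓ≥2} (-x_ℓ) into a multiple
-- of x₂ ⋯ xₙ, orthogonal to Δ since every monomial of Δ misses a variable; and it turns e_i into a
-- symmetric polynomial without constant term, all of whose multiples are orthogonal to Δ by
-- antisymmetry and homogeneity. Since x^L is not divisible by ∏_{ℓ>h(1)} x_ℓ, some x_ℓ with
-- ℓ > h(1) is absent from it; this leaves room to choose g with x^L · x₂ ⋯ x_{h(1)} · z^g = z^c for
-- a permutation c of the staircase (n-2, …, 0), where the coefficient of Δ is ±1.

open import Defs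
open import Algebra.Bundles using (CommutativeRing)
open import Data.Nat using (ℕ; suc; _≤_; _∸_)
open import Data.Fin using (Fin; toℕ)
open import Relation.Nullary using (¬_)

open import Level using (_⊔_)
open import Algebra.Bundles using (CommutativeMonoid)
open import Data.Nat as ℕ using (zero; _<_; _≤?_; _<?_; z≤n; s≤s)
import Data.Nat.Properties as ℕ
open import Data.Fin as Fin using (opposite)
import Data.Fin.Properties as Finₚ
open import Data.Vec as Vec using (Vec; []; _∷_; lookup; tabulate; toList; tail)
import Data.Vec.Properties as Vecₚ
open import Data.List as List using (List; []; _∷_; _++_; [_]; map; foldr; filter; length; allFin; upTo; applyUpTo)
import Data.List.Properties as Listₚ
open import Data.List.Membership.Propositional using (_∈_)
open import Data.List.Relation.Unary.All as All using (All; []; _∷_)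
open import Data.List.Relation.Unary.AllPairs using ([]; _∷_)
open import Data.List.Relation.Unary.Any using (here; there)
open import Data.List.Relation.Unary.Unique.Propositional using (Unique)
open import Data.List.Relation.Binary.Permutation.Propositional using (_↭_; ↭-refl; ↭-sym; ↭-trans; prep; swap)
open import Data.Product using (_×_; _,_; proj₁; proj₂; ∃-syntax)
open import Data.Sum using (_⊎_; inj₁; inj₂)
open import Data.Empty using (⊥-elim)
open import Data.Unit using (⊤)
open import Function using (_∘_; flip)
open import Relation.Nullary using (Dec; yes; no)
open import Relation.Nullary.Decidable using (_×-dec_; _→-dec_)
open import Relation.Binary.Definitions using (Tri; tri<; tri≈; tri>)
open import Relation.Binary.PropositionalEquality as ≡ using (_≡_; _≢_)

module Sums {c ℓ} (M : CommutativeMonoid c ℓ) where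
  open CommutativeMonoid M renaming (_∙_ to _+_; ε to 0#; ∙-cong to +-cong; ∙-congˡ to +-congˡ;
                                     identityˡ to +-identityˡ; identityʳ to +-identityʳ; assoc to +-assoc)
  open import Algebra.Properties.CommutativeSemigroup commutativeSemigroup
    using () renaming (interchange to +-interchange)

  ∑ : ∀ {a} {A : Set a} → (A → Carrier) → List A → Carrier
  ∑ f xs = foldr _+_ 0# (map f xs)

  module _ {a} {A : Set a} where
    ∑-cong : ∀ {f g : A → Carrier} xs → (∀ x → f x ≈ g x) → ∑ f xs ≈ ∑ g xs
    ∑-cong []       f≈g = refl
    ∑-cong (x ∷ xs) f≈g = +-cong (f≈g x) (∑-cong xs f≈g)

    ∑-++ : ∀ (f : A → Carrier) xs ys → ∑ f (xs ++ ys) ≈ ∑ f xs + ∑ f ys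
    ∑-++ f []       ys = sym (+-identityˡ _)
    ∑-++ f (x ∷ xs) ys = trans (+-congˡ (∑-++ f xs ys)) (sym (+-assoc _ _ _))

    ∑-+ : ∀ (f g : A → Carrier) xs → ∑ (λ x → f x + g x) xs ≈ ∑ f xs + ∑ g xs
    ∑-+ f g []       = sym (+-identityˡ _)
    ∑-+ f g (x ∷ xs) = trans (+-congˡ (∑-+ f g xs)) (+-interchange _ _ _ _)

    ∑-zero : ∀ (f : A → Carrier) xs → All (λ x → f x ≈ 0#) xs → ∑ f xs ≈ 0#
    ∑-zero f []       []         = refl
    ∑-zero f (x ∷ xs) (fx≈0 ∷ p) = trans (+-cong fx≈0 (∑-zero f xs p)) (+-identityˡ 0#)

    ∑-zero′ : ∀ (f : A → Carrier) xs → (∀ x → f x ≈ 0#) → ∑ f xs ≈ 0#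
    ∑-zero′ f xs f≈0 = ∑-zero f xs (All.universal f≈0 xs)

  ∑-map : ∀ {a b} {A : Set a} {B : Set b} (f : B → Carrier) (g : A → B) xs →
          ∑ f (map g xs) ≡ ∑ (λ x → f (g x)) xs
  ∑-map f g xs = ≡.cong (foldr _+_ 0#) (≡.sym (Listₚ.map-∘ xs))

  ∑-allFin-single : ∀ {m} (f : Fin m → Carrier) i → (∀ j → j ≢ i → f j ≈ 0#) →
                    ∑ f (allFin m) ≈ f i
  ∑-allFin-single {suc m} f i f≈0 = trans (+-congˡ (reflexive allFin-suc)) (go i f≈0)
    where
    allFin-suc : ∑ f (List.tabulate Fin.suc) ≡ ∑ (λ j → f (Fin.suc j)) (allFin m)
    allFin-suc = ≡.trans (≡.cong (∑ f) (≡.sym (Listₚ.map-tabulate (λ j → j) Fin.suc)))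
                         (∑-map f Fin.suc (allFin m))
    go : ∀ i → (∀ j → j ≢ i → f j ≈ 0#) → f Fin.zero + ∑ (λ j → f (Fin.suc j)) (allFin m) ≈ f i
    go Fin.zero    f≈0 = trans (+-congˡ (∑-zero′ _ (allFin m) (λ j → f≈0 (Fin.suc j) λ ())))
                               (+-identityʳ _)
    go (Fin.suc i) f≈0 = trans (+-cong (f≈0 Fin.zero λ ())
                                       (∑-allFin-single _ i λ j j≢i → f≈0 (Fin.suc j) (j≢i ∘ Finₚ.suc-injective)))
                               (+-identityˡ _)

module ExponentVectors where
  open import Data.Nat using (_+_; _*_)
  open import Data.Vec using (zipWith; replicate; updateAt; sum)
  open import Data.Vec.Relation.Binary.Pointwise.Inductive
    using (Pointwise-≡⇒≡; zipWith-assoc; zipWith-identityˡ; zipWith-identityʳ)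
  open import Algebra.Properties.CommutativeSemigroup ℕ.+-commutativeSemigroup
    using () renaming (interchange to +-interchange)
  open Sums ℕ.+-0-commutativeMonoid using (∑)

  private variable m : ℕ

  infixl 6 _⊞_
  _⊞_ : Vec ℕ m → Vec ℕ m → Vec ℕ m
  _⊞_ = zipWith _+_

  0⃗ : Vec ℕ m
  0⃗ = replicate _ 0

  unit : Fin m → Vec ℕ m
  unit i = updateAt 0⃗ i suc

  ⊞-assoc : ∀ (u v w : Vec ℕ m) → (u ⊞ v) ⊞ w ≡ u ⊞ (v ⊞ w)
  ⊞-assoc u v w = Pointwise-≡⇒≡ (zipWith-assoc ℕ.+-assoc u v w)

  ⊞-identityˡ : ∀ (u : Vec ℕ m) → 0⃗ ⊞ u ≡ u
  ⊞-identityˡ u = Pointwise-≡⇒≡ (zipWith-identityˡ ℕ.+-identityˡ u)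

  ⊞-identityʳ : ∀ (u : Vec ℕ m) → u ⊞ 0⃗ ≡ u
  ⊞-identityʳ u = Pointwise-≡⇒≡ (zipWith-identityʳ ℕ.+-identityʳ u)

  lookup-⊞ : ∀ (u v : Vec ℕ m) i → lookup (u ⊞ v) i ≡ lookup u i + lookup v i
  lookup-⊞ u v i = Vecₚ.lookup-zipWith _+_ i u v

  lookup-0⃗ : ∀ (i : Fin m) → lookup 0⃗ i ≡ 0
  lookup-0⃗ i = Vecₚ.lookup-replicate i 0

  lookup-unit-≡ : ∀ (i : Fin m) → lookup (unit i) i ≡ 1
  lookup-unit-≡ i = ≡.trans (Vecₚ.lookup∘updateAt i 0⃗) (≡.cong suc (lookup-0⃗ i))

  lookup-unit-≢ : ∀ {i j : Fin m} → i ≢ j → lookup (unit i) j ≡ 0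
  lookup-unit-≢ {i = i} {j} i≢j = ≡.trans (Vecₚ.lookup∘updateAt′ j i (i≢j ∘ ≡.sym) 0⃗) (lookup-0⃗ j)

  lookup-unit-≤1 : ∀ (i j : Fin m) → lookup (unit i) j ≤ 1
  lookup-unit-≤1 i j with i Finₚ.≟ j
  ... | yes ≡.refl = ℕ.≤-reflexive (lookup-unit-≡ i)
  ... | no  i≢j    = ℕ.≤-trans (ℕ.≤-reflexive (lookup-unit-≢ i≢j)) z≤n

  ≗⇒≡ : ∀ {u v : Vec ℕ m} → (∀ i → lookup u i ≡ lookup v i) → u ≡ v
  ≗⇒≡ {u = u} {v} u≗v = begin
    u                   ≡⟨ Vecₚ.tabulate∘lookup u ⟨
    tabulate (lookup u) ≡⟨ Vecₚ.tabulate-cong u≗v ⟩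
    tabulate (lookup v) ≡⟨ Vecₚ.tabulate∘lookup v ⟩
    v                   ∎
    where open ≡.≡-Reasoning

  sum-⊞ : ∀ (u v : Vec ℕ m) → sum (u ⊞ v) ≡ sum u + sum v
  sum-⊞ []       []       = ≡.refl
  sum-⊞ (a ∷ u) (b ∷ v) = ≡.trans (≡.cong (a + b +_) (sum-⊞ u v)) (+-interchange a b (sum u) (sum v))

  sum-0⃗ : sum (0⃗ {m}) ≡ 0
  sum-0⃗ {zero}  = ≡.refl
  sum-0⃗ {suc m} = sum-0⃗ {m}

  sum-unit : ∀ (i : Fin m) → sum (unit i) ≡ 1
  sum-unit {suc m} Fin.zero    = ≡.cong suc (sum-0⃗ {m})
  sum-unit         (Fin.suc i) = sum-unit i

  lookup≤sum : ∀ (v : Vec ℕ m) i → lookup v i ≤ sum v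
  lookup≤sum (a ∷ v) Fin.zero    = ℕ.m≤m+n a (sum v)
  lookup≤sum (a ∷ v) (Fin.suc i) = ℕ.≤-trans (lookup≤sum v i) (ℕ.m≤n+m (sum v) a)

  ∑⃗ : ∀ {a} {A : Set a} → (A → Vec ℕ m) → List A → Vec ℕ m
  ∑⃗ v xs = foldr _⊞_ 0⃗ (map v xs)

  lookup-∑⃗ : ∀ {a} {A : Set a} (v : A → Vec ℕ m) xs t → lookup (∑⃗ v xs) t ≡ ∑ (λ x → lookup (v x) t) xs
  lookup-∑⃗ v []       t = lookup-0⃗ t
  lookup-∑⃗ v (x ∷ xs) t = ≡.trans (lookup-⊞ (v x) _ t) (≡.cong (lookup (v x) t +_) (lookup-∑⃗ v xs t))

  infixr 7 _·⃗_
  _·⃗_ : ℕ → Vec ℕ m → Vec ℕ m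
  zero  ·⃗ v = 0⃗
  suc k ·⃗ v = v ⊞ k ·⃗ v

  lookup-·⃗ : ∀ k (v : Vec ℕ m) t → lookup (k ·⃗ v) t ≡ k * lookup v t
  lookup-·⃗ zero    v t = lookup-0⃗ t
  lookup-·⃗ (suc k) v t = ≡.trans (lookup-⊞ v _ t) (≡.cong (lookup v t +_) (lookup-·⃗ k v t))

  indicator : List (Fin m) → Vec ℕ m
  indicator = ∑⃗ unit

  lookup-indicator-∉ : ∀ (R : List (Fin m)) {j} → All (_≢ j) R → lookup (indicator R) j ≡ 0
  lookup-indicator-∉ []      {j} []           = lookup-0⃗ j
  lookup-indicator-∉ (i ∷ R) {j} (i≢j ∷ j∉R) =
    ≡.trans (lookup-⊞ (unit i) _ j) (≡.cong₂ _+_ (lookup-unit-≢ i≢j) (lookup-indicator-∉ R j∉R))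

  lookup-indicator-∈ : ∀ (R : List (Fin m)) {j} → j ∈ R → 1 ≤ lookup (indicator R) j
  lookup-indicator-∈ (i ∷ R) {j} j∈iR = ≡.subst (1 ≤_) (≡.sym (lookup-⊞ (unit i) _ j)) (go j∈iR)
    where
    go : j ∈ i ∷ R → 1 ≤ lookup (unit i) j + lookup (indicator R) j
    go (here ≡.refl) = ≡.subst (λ a → 1 ≤ a + lookup (indicator R) i) (≡.sym (lookup-unit-≡ i)) (s≤s z≤n)
    go (there j∈R)   = ℕ.≤-trans (lookup-indicator-∈ R j∈R) (ℕ.m≤n+m _ _)

  lookup-indicator-≤1 : ∀ {R : List (Fin m)} → Unique R → ∀ j → lookup (indicator R) j ≤ 1
  lookup-indicator-≤1 {R = []}    []          j = ℕ.≤-trans (ℕ.≤-reflexive (lookup-0⃗ j)) z≤n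
  lookup-indicator-≤1 {R = i ∷ R} (i∉R ∷ R!) j rewrite lookup-⊞ (unit i) (indicator R) j with i Finₚ.≟ j
  ... | yes ≡.refl = ℕ.≤-reflexive (≡.cong₂ _+_ (lookup-unit-≡ i) (lookup-indicator-∉ R (All.map (_∘ ≡.sym) i∉R)))
  ... | no  i≢j    = ≡.subst (λ a → a + _ ≤ 1) (≡.sym (lookup-unit-≢ i≢j)) (lookup-indicator-≤1 R! j)

  indicator-map-suc : ∀ (R : List (Fin m)) → indicator (map Fin.suc R) ≡ 0 ∷ indicator R
  indicator-map-suc []      = ≡.refl
  indicator-map-suc (i ∷ R) = ≡.cong (unit (Fin.suc i) ⊞_) (indicator-map-suc R)

  ∷-⊞-indicator-map-suc : ∀ a (α : Vec ℕ m) S → (a ∷ α) ⊞ indicator (map Fin.suc S) ≡ a ∷ α ⊞ indicator S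
  ∷-⊞-indicator-map-suc a α S rewrite indicator-map-suc S = ≡.cong (_∷ _) (ℕ.+-identityʳ a)

  ∷-⊞-indicator-zero∷map-suc : ∀ a (α : Vec ℕ m) S →
                               (a ∷ α) ⊞ indicator (Fin.zero ∷ map Fin.suc S) ≡ suc a ∷ α ⊞ indicator S
  ∷-⊞-indicator-zero∷map-suc a α S rewrite indicator-map-suc S =
    ≡.cong₂ (λ b v → b ∷ α ⊞ v) (ℕ.+-comm a 1) (⊞-identityˡ (indicator S))

  ∷-⊞ : ∀ a (α : Vec ℕ m) v → lookup v Fin.zero ≡ 0 → (a ∷ α) ⊞ v ≡ a ∷ (α ⊞ Vec.tail v)
  ∷-⊞ a α (0 ∷ v) ≡.refl = ≡.cong (_∷ (α ⊞ v)) (ℕ.+-identityʳ a)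

  lookup-⊞-unit : ∀ (β : Vec ℕ m) i → lookup (β ⊞ unit i) i ≡ suc (lookup β i)
  lookup-⊞-unit β i =
    ≡.trans (lookup-⊞ β (unit i) i) (≡.trans (≡.cong (lookup β i +_) (lookup-unit-≡ i)) (ℕ.+-comm _ 1))

  sum-⊞-unit : ∀ (β : Vec ℕ m) i → sum (β ⊞ unit i) ≡ suc (sum β)
  sum-⊞-unit β i = ≡.trans (sum-⊞ β (unit i)) (≡.trans (≡.cong (sum β +_) (sum-unit i)) (ℕ.+-comm _ 1))

  lookup-tail : ∀ (v : Vec ℕ (suc m)) i → lookup (Vec.tail v) i ≡ lookup v (Fin.suc i)
  lookup-tail (_ ∷ v) i = ≡.refl

  lookup-≤-⊞ˡ : ∀ (u v : Vec ℕ m) i → lookup u i ≤ lookup (u ⊞ v) i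
  lookup-≤-⊞ˡ u v i = ℕ.≤-trans (ℕ.m≤m+n _ _) (ℕ.≤-reflexive (≡.sym (lookup-⊞ u v i)))

  lookup-≤-⊞ʳ : ∀ (u v : Vec ℕ m) i → lookup v i ≤ lookup (u ⊞ v) i
  lookup-≤-⊞ʳ u v i = ℕ.≤-trans (ℕ.m≤n+m _ _) (ℕ.≤-reflexive (≡.sym (lookup-⊞ u v i)))

open ExponentVectors

applyUpTo-+ : ∀ {a} {A : Set a} (f : ℕ → A) m r →
              applyUpTo f (m ℕ.+ r) ≡ applyUpTo f m ++ applyUpTo (λ s → f (m ℕ.+ s)) r
applyUpTo-+ f zero    r = ≡.refl
applyUpTo-+ f (suc m) r = ≡.cong (f 0 ∷_) (applyUpTo-+ (λ s → f (suc s)) m r)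

toList-tabulate-toℕ : ∀ {a} {A : Set a} (f : ℕ → A) m → toList (tabulate {n = m} (f ∘ toℕ)) ≡ applyUpTo f m
toList-tabulate-toℕ f zero    = ≡.refl
toList-tabulate-toℕ f (suc m) = ≡.cong (f 0 ∷_) (toList-tabulate-toℕ (f ∘ suc) m)

applyUpTo-cong : ∀ {a} {A : Set a} {f g : ℕ → A} m → (∀ s → s < m → f s ≡ g s) → applyUpTo f m ≡ applyUpTo g m
applyUpTo-cong zero    f≡g = ≡.refl
applyUpTo-cong (suc m) f≡g = ≡.cong₂ _∷_ (f≡g 0 (s≤s z≤n)) (applyUpTo-cong m λ s s<m → f≡g (suc s) (s≤s s<m))

module Cycle (t₀ : ℕ) where
  open import Data.List.Relation.Binary.Permutation.Propositional.Properties using (shift)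

  cycle : ℕ → ℕ
  cycle s with ℕ.<-cmp s t₀
  ... | tri< _ _ _ = suc s
  ... | tri≈ _ _ _ = 0
  ... | tri> _ _ _ = s

  cycle-< : ∀ {s} → s < t₀ → cycle s ≡ suc s
  cycle-< {s} s<t₀ with ℕ.<-cmp s t₀
  ... | tri< _ _ _  = ≡.refl
  ... | tri≈ ¬< _ _ = ⊥-elim (¬< s<t₀)
  ... | tri> ¬< _ _ = ⊥-elim (¬< s<t₀)

  cycle-≡ : cycle t₀ ≡ 0
  cycle-≡ with ℕ.<-cmp t₀ t₀
  ... | tri< _ ¬≡ _ = ⊥-elim (¬≡ ≡.refl)
  ... | tri≈ _ _ _  = ≡.refl
  ... | tri> _ ¬≡ _ = ⊥-elim (¬≡ ≡.refl)

  cycle-> : ∀ {s} → t₀ < s → cycle s ≡ s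
  cycle-> {s} t₀<s with ℕ.<-cmp s t₀
  ... | tri< _ _ ¬> = ⊥-elim (¬> t₀<s)
  ... | tri≈ _ _ ¬> = ⊥-elim (¬> t₀<s)
  ... | tri> _ _ _  = ≡.refl

  applyUpTo-cycle-↭ : ∀ r → applyUpTo cycle (suc t₀ ℕ.+ r) ↭ upTo (suc t₀ ℕ.+ r)
  applyUpTo-cycle-↭ r = ≡.subst₂ _↭_ (≡.sym cycled) (≡.sym (applyUpTo-+ (λ s → s) (suc t₀) r)) (shift 0 below above)
    where
    below = applyUpTo suc t₀
    above = applyUpTo (λ s → suc t₀ ℕ.+ s) r
    cycled : applyUpTo cycle (suc t₀ ℕ.+ r) ≡ below ++ 0 ∷ above
    cycled = begin
      applyUpTo cycle (suc t₀ ℕ.+ r)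
        ≡⟨ applyUpTo-+ cycle (suc t₀) r ⟩
      applyUpTo cycle (suc t₀) ++ applyUpTo (λ s → cycle (suc t₀ ℕ.+ s)) r
        ≡⟨ ≡.cong₂ _++_ (Listₚ.applyUpTo-∷ʳ cycle t₀) ≡.refl ⟨
      (applyUpTo cycle t₀ ++ [ cycle t₀ ]) ++ applyUpTo (λ s → cycle (suc t₀ ℕ.+ s)) r
        ≡⟨ ≡.cong₂ (λ xs ys → (xs ++ [ cycle t₀ ]) ++ ys) (applyUpTo-cong t₀ λ _ → cycle-<)
                                                           (applyUpTo-cong r λ s _ → cycle-> (s≤s (ℕ.m≤m+n t₀ s))) ⟩
      (below ++ [ cycle t₀ ]) ++ above
        ≡⟨ ≡.cong (λ c → (below ++ [ c ]) ++ above) cycle-≡ ⟩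
      (below ++ [ 0 ]) ++ above
        ≡⟨ Listₚ.++-assoc below [ 0 ] above ⟩
      below ++ 0 ∷ above ∎
      where open ≡.≡-Reasoning

module LinearExtension {c ℓ} (K : CommutativeRing c ℓ) (n : ℕ) where
  open import Data.List.Membership.Propositional.Properties using (∈-++⁺ˡ; ∈-++⁺ʳ)
  open import Data.List.Relation.Unary.Any.Properties using (deduplicate⁺)
  open import Data.List.Relation.Unary.Unique.DecPropositional.Properties using (deduplicate-!)
  open CommutativeRing K
  open import Algebra.Properties.Ring ring using (-0#≈0#; -‿+-comm; -‿distribˡ-*)
  open import Relation.Binary.Reasoning.Setoid setoid
  open Poly K n
  open Sums +-commutativeMonoid

  extend : (Mon n → Carrier) → P → Carrier
  extend f = ∑ (λ (a , m) → a * f m)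

  extend-zero : ∀ (f : Mon n → Carrier) p → (∀ m → f m ≈ 0#) → extend f p ≈ 0#
  extend-zero f p f≈0 = ∑-zero′ _ p λ (a , m) → trans (*-congˡ (f≈0 m)) (zeroʳ a)

  extend-⊕ : ∀ f p q → extend f (p ⊕ q) ≈ extend f p + extend f q
  extend-⊕ f p q = ∑-++ _ p q

  extend-⊖ : ∀ f p → extend f (⊖ p) ≈ - extend f p
  extend-⊖ f []            = sym -0#≈0#
  extend-⊖ f ((a , m) ∷ p) =
    trans (+-cong (sym (-‿distribˡ-* a (f m))) (extend-⊖ f p)) (-‿+-comm _ _)

  extend-⊝ : ∀ f p q → extend f (p ⊝ q) ≈ extend f p - extend f q
  extend-⊝ f p q = trans (extend-⊕ f p (⊖ q)) (+-congˡ (extend-⊖ f q))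

  extend-ΣP : ∀ f ps → extend f (ΣP ps) ≈ ∑ (extend f) ps
  extend-ΣP f []       = refl
  extend-ΣP f (p ∷ ps) = trans (extend-⊕ f p (ΣP ps)) (+-congˡ (extend-ΣP f ps))

  extend-⊛ : ∀ f p q → extend f (p ⊛ q) ≈ extend (λ u → extend (f ∘ mulMon u) q) p
  extend-⊛ f []            q = refl
  extend-⊛ f ((a , m) ∷ p) q =
    trans (∑-++ _ (map _ q) (p ⊛ q)) (+-cong (scaled q) (extend-⊛ f p q))
    where
    scaled : ∀ q → extend f (map (λ (b , m′) → (a * b , mulMon m m′)) q) ≈ a * extend (f ∘ mulMon m) q
    scaled []             = sym (zeroʳ a)
    scaled ((b , m′) ∷ q) = trans (+-cong (*-assoc a b _) (scaled q)) (sym (distribˡ a _ _))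

  termCoeff : Carrier → Mon n → Mon n → Carrier
  termCoeff a m u with m ≟M u
  ... | yes _ = a
  ... | no  _ = 0#

  coeff-∷ : ∀ a m p u → coeff ((a , m) ∷ p) u ≡ termCoeff a m u + coeff p u
  coeff-∷ a m p u with m ≟M u
  ... | yes _ = ≡.refl
  ... | no  _ = ≡.refl

  termCoeff-≡ : ∀ a m → termCoeff a m m ≡ a
  termCoeff-≡ a m with m ≟M m
  ... | yes _   = ≡.refl
  ... | no  m≢m = ⊥-elim (m≢m ≡.refl)

  termCoeff-≢ : ∀ a {m u} → m ≢ u → termCoeff a m u ≡ 0#
  termCoeff-≢ a {m} {u} m≢u with m ≟M u
  ... | yes m≡u = ⊥-elim (m≢u m≡u)
  ... | no  _   = ≡.refl

  termCoeff-scale : ∀ a m u → termCoeff a m u ≈ a * termCoeff 1# m u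
  termCoeff-scale a m u with m ≟M u
  ... | yes _ = sym (*-identityʳ a)
  ... | no  _ = sym (zeroʳ a)

  coeff-extend : ∀ p u → coeff p u ≈ extend (λ m → termCoeff 1# m u) p
  coeff-extend []            u = refl
  coeff-extend ((a , m) ∷ p) u =
    trans (reflexive (coeff-∷ a m p u)) (+-cong (termCoeff-scale a m u) (coeff-extend p u))

  ∑-termCoeff : ∀ (f : Mon n → Carrier) a {m} {M : List (Mon n)} → Unique M → m ∈ M →
                ∑ (λ u → termCoeff a m u * f u) M ≈ a * f m
  ∑-termCoeff f a {m} {M = .m ∷ M} (m∉M ∷ M!) (here ≡.refl) = begin
    termCoeff a m m * f m + ∑ (λ u → termCoeff a m u * f u) M
      ≈⟨ +-cong (*-congʳ (reflexive (termCoeff-≡ a m))) (∑-zero _ M (All.map vanish m∉M)) ⟩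
    a * f m + 0#
      ≈⟨ +-identityʳ _ ⟩
    a * f m ∎
    where
    vanish : ∀ {u} → m ≢ u → termCoeff a m u * f u ≈ 0#
    vanish m≢u = trans (*-congʳ (reflexive (termCoeff-≢ a m≢u))) (zeroˡ _)
  ∑-termCoeff f a {m} {M = u ∷ M} (u∉M ∷ M!) (there m∈M) =
    trans (+-cong (trans (*-congʳ (reflexive (termCoeff-≢ a m≢u))) (zeroˡ _)) (∑-termCoeff f a M! m∈M))
          (+-identityˡ _)
    where
    m≢u : m ≢ u
    m≢u m≡u = All.lookup u∉M m∈M (≡.sym m≡u)

  extend-by-coeff : ∀ (f : Mon n → Carrier) {M} → Unique M → ∀ p → All (λ (_ , m) → m ∈ M) p →
                    extend f p ≈ ∑ (λ u → coeff p u * f u) M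
  extend-by-coeff f {M} M! []            []            = sym (∑-zero′ _ M λ u → zeroˡ _)
  extend-by-coeff f {M} M! ((a , m) ∷ p) (m∈M ∷ p⊆M) = begin
    a * f m + extend f p
      ≈⟨ +-cong (sym (∑-termCoeff f a M! m∈M)) (extend-by-coeff f M! p p⊆M) ⟩
    ∑ (λ u → termCoeff a m u * f u) M + ∑ (λ u → coeff p u * f u) M
      ≈⟨ sym (∑-+ _ _ M) ⟩
    ∑ (λ u → termCoeff a m u * f u + coeff p u * f u) M
      ≈⟨ ∑-cong M (λ u → trans (sym (distribʳ _ _ _)) (*-congʳ (reflexive (≡.sym (coeff-∷ a m p u))))) ⟩
    ∑ (λ u → coeff ((a , m) ∷ p) u * f u) M ∎

  extend-resp-≃ : ∀ f {p q} → p ≃ q → extend f p ≈ extend f q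
  extend-resp-≃ f {p} {q} p≃q = begin
    extend f p                    ≈⟨ extend-by-coeff f M! p (support⊆M p ∈-++⁺ˡ) ⟩
    ∑ (λ u → coeff p u * f u) M  ≈⟨ ∑-cong M (λ u → *-congʳ (p≃q u)) ⟩
    ∑ (λ u → coeff q u * f u) M  ≈⟨ extend-by-coeff f M! q (support⊆M q (∈-++⁺ʳ (map proj₂ p))) ⟨
    extend f q                    ∎
    where
    supports = map proj₂ p ++ map proj₂ q
    M = List.deduplicate _≟M_ supports
    M! : Unique M
    M! = deduplicate-! _≟M_ supports
    support⊆M : ∀ r → (∀ {u} → u ∈ map proj₂ r → u ∈ supports) → All (λ (_ , m) → m ∈ M) r
    support⊆M []      r⊆ = []
    support⊆M (t ∷ r) r⊆ = deduplicate⁺ _≟M_ (λ { ≡.refl u → u }) (r⊆ (here ≡.refl))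
                         ∷ support⊆M r (r⊆ ∘ there)

module Terms {c ℓ} (K : CommutativeRing c ℓ) (n : ℕ) where
  open CommutativeRing K hiding (zero)
  open import Relation.Binary.Reasoning.Setoid setoid
  open Poly K n
  open LinearExtension K n
  open Sums *-commutativeMonoid using () renaming (∑ to ∏)

  xMon : Vec ℕ n → Mon n
  xMon α = α , 0⃗

  yMon : Vec ℕ n → Mon n
  yMon β = 0⃗ , β

  mulMon-xMon : ∀ α α′ → mulMon (xMon α) (xMon α′) ≡ xMon (α ⊞ α′)
  mulMon-xMon α α′ = ≡.cong (α ⊞ α′ ,_) (⊞-identityˡ 0⃗)

  mulMon-identityˡ : ∀ m → mulMon one-mon m ≡ m
  mulMon-identityˡ (α , β) = ≡.cong₂ _,_ (⊞-identityˡ α) (⊞-identityˡ β)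

  mulMon-xMonʳ : ∀ α β v → mulMon (α , β) (xMon v) ≡ (α ⊞ v , β)
  mulMon-xMonʳ α β v = ≡.cong (α ⊞ v ,_) (⊞-identityʳ β)

  mulMon-yMonʳ : ∀ α β w → mulMon (α , β) (yMon w) ≡ (α , β ⊞ w)
  mulMon-yMonʳ α β w = ≡.cong (_, β ⊞ w) (⊞-identityʳ α)

  mulMon-xMon-yMon : ∀ α β → mulMon (xMon α) (yMon β) ≡ (α , β)
  mulMon-xMon-yMon α β = ≡.cong₂ _,_ (⊞-identityʳ α) (⊞-identityˡ β)

  IsTerm : P → Carrier → Mon n → Set (c ⊔ ℓ)
  IsTerm p a m = ∀ f → extend f p ≈ a * f m

  isTerm-singleton : ∀ a m → IsTerm ((a , m) ∷ []) a m
  isTerm-singleton a m f = +-identityʳ _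

  isTerm-resp : ∀ p {a b m m′} → a ≈ b → m ≡ m′ → IsTerm p a m → IsTerm p b m′
  isTerm-resp p a≈b ≡.refl p~ f = trans (p~ f) (*-congʳ a≈b)

  isTerm-⊛ : ∀ p q {a b m m′} → IsTerm p a m → IsTerm q b m′ → IsTerm (p ⊛ q) (a * b) (mulMon m m′)
  isTerm-⊛ p q {a} {b} {m} {m′} p~ q~ f = begin
    extend f (p ⊛ q)                          ≈⟨ extend-⊛ f p q ⟩
    extend (λ u → extend (f ∘ mulMon u) q) p  ≈⟨ p~ _ ⟩
    a * extend (f ∘ mulMon m) q               ≈⟨ *-congˡ (q~ _) ⟩
    a * (b * f (mulMon m m′))                 ≈⟨ *-assoc a b _ ⟨
    a * b * f (mulMon m m′)                   ∎

  isTerm-^P : ∀ p {a α} → IsTerm p a (xMon α) → ∀ k → IsTerm (p ^P k) (pow K a k) (xMon (k ·⃗ α))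
  isTerm-^P p         p~ zero    = isTerm-singleton 1# one-mon
  isTerm-^P p {α = α} p~ (suc k) =
    isTerm-resp (p ^P suc k) refl (mulMon-xMon α _) (isTerm-⊛ p (p ^P k) p~ (isTerm-^P p p~ k))

  isTerm-ΠP : ∀ {b} {B : Set b} (F : B → P) {a : B → Carrier} {v : B → Vec ℕ n} →
              (∀ j → IsTerm (F j) (a j) (xMon (v j))) → ∀ L → IsTerm (ΠP (map F L)) (∏ a L) (xMon (∑⃗ v L))
  isTerm-ΠP F         F~ []      = isTerm-singleton 1# one-mon
  isTerm-ΠP F {v = v} F~ (j ∷ L) =
    isTerm-resp (ΠP (map F (j ∷ L))) refl (mulMon-xMon (v j) _)
                (isTerm-⊛ (F j) (ΠP (map F L)) (F~ j) (isTerm-ΠP F F~ L))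

  ∏-const : ∀ {b} {B : Set b} a (L : List B) → ∏ (λ _ → a) L ≡ pow K a (length L)
  ∏-const a []      = ≡.refl
  ∏-const a (_ ∷ L) = ≡.cong (a *_) (∏-const a L)

  pow-1# : ∀ k → pow K 1# k ≈ 1#
  pow-1# zero    = refl
  pow-1# (suc k) = trans (*-identityˡ _) (pow-1# k)

  isTerm-Πx : ∀ R → IsTerm (ΠP (map x R)) 1# (xMon (indicator R))
  isTerm-Πx R = isTerm-resp (ΠP (map x R)) (trans (reflexive (∏-const 1# R)) (pow-1# (length R))) ≡.refl
                            (isTerm-ΠP x (λ i → isTerm-singleton _ _) R)

  isTerm-Π⊖x : ∀ R → IsTerm (ΠP (map (λ l → ⊖ x l) R)) (pow K (- 1#) (length R)) (xMon (indicator R))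
  isTerm-Π⊖x R = isTerm-resp (ΠP (map (λ l → ⊖ x l) R)) (reflexive (∏-const (- 1#) R)) ≡.refl
                             (isTerm-ΠP (λ l → ⊖ x l) (λ i → isTerm-singleton _ _) R)

  isTerm-≃ : ∀ p q {a m} → IsTerm p a m → IsTerm q a m → p ≃ q
  isTerm-≃ p q p~ q~ u = begin
    coeff p u                            ≈⟨ coeff-extend p u ⟩
    extend (λ m → termCoeff 1# m u) p   ≈⟨ p~ _ ⟩
    _                                    ≈⟨ q~ _ ⟨
    extend (λ m → termCoeff 1# m u) q   ≈⟨ coeff-extend q u ⟨
    coeff q u                            ∎

module Alternating {c ℓ} (K : CommutativeRing c ℓ) where
  open CommutativeRing K hiding (zero)
  open import Algebra.Properties.Ring ring using (-0#≈0#; -‿involutive; -‿+-comm; -‿distribʳ-*; -1*x≈-x)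
  open import Algebra.Properties.CommutativeSemigroup *-commutativeSemigroup
    using () renaming (interchange to *-interchange)
  open import Algebra.Properties.CommutativeSemigroup +-commutativeSemigroup
    using () renaming (interchange to +-interchange)
  open import Relation.Binary.Reasoning.Setoid setoid
  open import Algebra.Properties.Group +-group using () renaming (//-cong₂ to −-cong)

  −-+-interchange : ∀ a b c d → (a - b) + (c - d) ≈ (a + c) - (b + d)
  −-+-interchange a b c d = trans (+-interchange a (- b) c (- d)) (+-congˡ (-‿+-comm b d))

  −0 : ∀ a → a - 0# ≈ a
  −0 a = trans (+-congˡ -0#≈0#) (+-identityʳ a)

  sign : ℕ → Carrier
  sign = pow K (- 1#)

  sign-+ : ∀ j k → sign (j ℕ.+ k) ≈ sign j * sign k
  sign-+ zero    k = sym (*-identityˡ _)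
  sign-+ (suc j) k = trans (*-congˡ (sign-+ j k)) (sym (*-assoc _ _ _))

  sign-square : ∀ k → sign k * sign k ≈ 1#
  sign-square zero    = *-identityˡ 1#
  sign-square (suc k) = begin
    (- 1# * sign k) * (- 1# * sign k) ≈⟨ *-interchange _ _ _ _ ⟩
    (- 1# * - 1#) * (sign k * sign k) ≈⟨ *-cong (trans (-1*x≈-x (- 1#)) (-‿involutive 1#)) (sign-square k) ⟩
    1# * 1#                           ≈⟨ *-identityˡ 1# ⟩
    1#                                ∎

  module _ {a} {A : Set a} where

    -- alternate g c = ∑ᵢ (-1)ⁱ g cᵢ (c with its i-th entry removed)
    alternate : (A → List A → Carrier) → List A → Carrier
    alternate g []       = 0#
    alternate g (x ∷ xs) = g x xs - alternate (λ y ys → g y (x ∷ ys)) xs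

    alternate-cong : ∀ {g h} c → (∀ y ys → g y ys ≈ h y ys) → alternate g c ≈ alternate h c
    alternate-cong []       g≈h = refl
    alternate-cong (x ∷ xs) g≈h = −-cong (g≈h x xs) (alternate-cong xs λ y ys → g≈h y (x ∷ ys))

    alternate-+ : ∀ g h c → alternate (λ y ys → g y ys + h y ys) c ≈ alternate g c + alternate h c
    alternate-+ g h []       = sym (+-identityˡ 0#)
    alternate-+ g h (x ∷ xs) = trans (−-cong refl (alternate-+ _ _ xs)) (sym (−-+-interchange _ _ _ _))

    alternate-neg : ∀ g c → alternate (λ y ys → - g y ys) c ≈ - alternate g c
    alternate-neg g []       = sym -0#≈0#
    alternate-neg g (x ∷ xs) = trans (+-congˡ (-‿cong (alternate-neg _ xs))) (-‿+-comm _ _)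

    alternate-− : ∀ g h c → alternate (λ y ys → g y ys - h y ys) c ≈ alternate g c - alternate h c
    alternate-− g h c = trans (alternate-+ g _ c) (+-congˡ (alternate-neg h c))

    alternate-*ˡ : ∀ a g c → alternate (λ y ys → a * g y ys) c ≈ a * alternate g c
    alternate-*ˡ a g []       = sym (zeroʳ a)
    alternate-*ˡ a g (x ∷ xs) = begin
      a * g x xs - alternate (λ y ys → a * g y (x ∷ ys)) xs ≈⟨ −-cong refl (alternate-*ˡ a _ xs) ⟩
      a * g x xs - a * alternate (λ y ys → g y (x ∷ ys)) xs ≈⟨ +-congˡ (-‿distribʳ-* a _) ⟩
      a * g x xs + a * - alternate (λ y ys → g y (x ∷ ys)) xs ≈⟨ distribˡ a _ _ ⟨
      a * (g x xs - alternate (λ y ys → g y (x ∷ ys)) xs)     ∎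

    alternate-zero : ∀ {p} {Q : A → Set p} g c → All Q c → (∀ y ys → Q y → g y ys ≈ 0#) →
                     alternate g c ≈ 0#
    alternate-zero g []       []         _   = refl
    alternate-zero g (x ∷ xs) (Qx ∷ Qxs) g≈0 =
      trans (−-cong (g≈0 x xs Qx) (alternate-zero _ xs Qxs λ y ys → g≈0 y (x ∷ ys))) (−0 0#)

    alternate-zero-↭ : ∀ g c → (∀ y ys → y ∷ ys ↭ c → g y ys ≈ 0#) → alternate g c ≈ 0#
    alternate-zero-↭ g []       g≈0 = refl
    alternate-zero-↭ g (x ∷ xs) g≈0 = trans (−-cong (g≈0 x xs ↭-refl) (alternate-zero-↭ _ xs rest)) (−0 0#)
      where
      rest : ∀ y ys → y ∷ ys ↭ xs → g y (x ∷ ys) ≈ 0#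
      rest y ys p = g≈0 y (x ∷ ys) (↭-trans (swap y x ↭-refl) (prep x p))

    alternate²-symmetric : ∀ (k : A → A → List A → Carrier) → (∀ y z zs → k y z zs ≈ k z y zs) →
                           ∀ c → alternate (λ y ys → alternate (λ z zs → k y z zs) ys) c ≈ 0#
    alternate²-symmetric k k-sym []       = refl
    alternate²-symmetric k k-sym (x ∷ xs) = begin
      S - alternate (λ y ys → k y x ys - alternate (λ z zs → k y z (x ∷ zs)) ys) xs
        ≈⟨ −-cong refl (alternate-− _ _ xs) ⟩
      S - (alternate (λ y ys → k y x ys) xs - alternate (λ y ys → alternate (λ z zs → k y z (x ∷ zs)) ys) xs)
        ≈⟨ −-cong refl (−-cong (alternate-cong xs λ y ys → k-sym y x ys) inner) ⟩
      S - (S - 0#)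
        ≈⟨ −-cong refl (−0 S) ⟩
      S - S
        ≈⟨ -‿inverseʳ S ⟩
      0# ∎
      where
      S = alternate (λ z zs → k x z zs) xs
      inner = alternate²-symmetric (λ y z zs → k y z (x ∷ zs)) (λ y z zs → k-sym y z (x ∷ zs)) xs


    alternate-single : ∀ (g : A → List A → Carrier) v pre suf → All (_≢ v) pre → All (_≢ v) suf →
                       (∀ y ys → y ≢ v → g y ys ≈ 0#) →
                       ∃[ k ] alternate g (pre ++ v ∷ suf) ≈ sign k * g v (pre ++ suf)
    alternate-single g v [] suf _ suf≢v g≈0 = 0 , (begin
      g v suf - alternate (λ y ys → g y (v ∷ ys)) suf
        ≈⟨ −-cong refl (alternate-zero _ suf suf≢v λ y ys → g≈0 y (v ∷ ys)) ⟩
      g v suf - 0# ≈⟨ −0 _ ⟩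
      g v suf      ≈⟨ *-identityˡ _ ⟨
      1# * g v suf ∎)
    alternate-single g v (x ∷ pre) suf (x≢v ∷ pre≢v) suf≢v g≈0 = suc k , (begin
      g x _ - alternate g′ (pre ++ v ∷ suf) ≈⟨ −-cong (g≈0 x _ x≢v) alt≈ ⟩
      0# - sign k * G                       ≈⟨ +-identityˡ _ ⟩
      - (sign k * G)                        ≈⟨ -1*x≈-x _ ⟨
      - 1# * (sign k * G)                   ≈⟨ *-assoc _ _ _ ⟨
      (- 1# * sign k) * G                   ∎)
      where
      G = g v (x ∷ pre ++ suf)
      g′ = λ y ys → g y (x ∷ ys)
      IH = alternate-single g′ v pre suf pre≢v suf≢v (λ y ys → g≈0 y (x ∷ ys))
      k = proj₁ IH
      alt≈ = proj₂ IH

module Vandermonde {c ℓ} (K : CommutativeRing c ℓ) where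
  open import Data.Nat using (_≡ᵇ_)
  open import Data.Nat.ListAction using (sum)
  open import Data.Nat.ListAction.Properties using (sum-↭)
  open import Data.Bool using (if_then_else_)
  open import Data.List.Membership.Propositional.Properties using (∈-∃++; ∈-upTo⁻; ∈-upTo⁺)
  open import Data.List.Relation.Unary.All.Properties using (++⁻ˡ; ++⁻ʳ)
  open import Data.List.Relation.Binary.Permutation.Propositional.Properties
    using (All-resp-↭; ∈-resp-↭; drop-mid; ↭-empty-inv)
  open CommutativeRing K hiding (zero)
  open import Algebra.Properties.Ring ring using (-‿+-comm)
  open import Algebra.Properties.CommutativeSemigroup *-commutativeSemigroup
    using () renaming (x∙yz≈y∙xz to *-lcomm)
  open import Algebra.Properties.CommutativeSemigroup +-commutativeSemigroup
    using () renaming (interchange to +-interchange)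
  open import Algebra.Properties.Group +-group using () renaming (//-cong₂ to −-cong)
  open import Relation.Binary.Reasoning.Setoid setoid
  open Alternating K

  δ : ℕ → ℕ → Carrier
  δ a b = if a ≡ᵇ b then 1# else 0#

  δ-refl : ∀ a → δ a a ≡ 1#
  δ-refl zero    = ≡.refl
  δ-refl (suc a) = δ-refl a

  δ-≢ : ∀ {a b} → a ≢ b → δ a b ≡ 0#
  δ-≢ {zero}  {zero}  a≢b = ⊥-elim (a≢b ≡.refl)
  δ-≢ {zero}  {suc b} a≢b = ≡.refl
  δ-≢ {suc a} {zero}  a≢b = ≡.refl
  δ-≢ {suc a} {suc b} a≢b = δ-≢ (a≢b ∘ ≡.cong suc)

  δ-≢-* : ∀ {a b} → a ≢ b → ∀ x → δ a b * x ≈ 0#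
  δ-≢-* a≢b x = trans (*-congʳ (reflexive (δ-≢ a≢b))) (zeroˡ x)

  -- vandermonde N c is the coefficient of z^c in ∏_{i<j<N} (zᵢ - zⱼ) = det (zᵢ^(N-1-j));
  -- the recursion is the Laplace expansion along the column of highest powers.
  vandermonde : ℕ → List ℕ → Carrier
  vandermonde zero    []      = 1#
  vandermonde zero    (_ ∷ _) = 0#
  vandermonde (suc N) c       = alternate (λ y ys → δ y N * vandermonde N ys) c

  triangular : ℕ → ℕ
  triangular zero    = 0
  triangular (suc N) = N ℕ.+ triangular N

  vandermonde-homogeneous : ∀ N c → sum c ≢ triangular N → vandermonde N c ≈ 0#
  vandermonde-homogeneous zero    []      0≢0 = ⊥-elim (0≢0 ≡.refl)
  vandermonde-homogeneous zero    (_ ∷ _) _   = refl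
  vandermonde-homogeneous (suc N) c       c≢  = alternate-zero-↭ _ c term≈0
    where
    term≈0 : ∀ y ys → y ∷ ys ↭ c → δ y N * vandermonde N ys ≈ 0#
    term≈0 y ys p with y ℕ.≟ N
    ... | no  y≢N    = δ-≢-* y≢N _
    ... | yes ≡.refl = trans (*-congˡ (vandermonde-homogeneous N ys ys≢)) (zeroʳ _)
      where ys≢ = λ ys≡ → c≢ (≡.trans (≡.sym (sum-↭ p)) (≡.cong (y ℕ.+_) ys≡))

  vandermonde-positive : ∀ N c → 1 ≤ N → All (1 ≤_) c → vandermonde N c ≈ 0#
  vandermonde-positive (suc N) c _ c≥1 = alternate-zero-↭ _ c term≈0
    where
    term≈0 : ∀ y ys → y ∷ ys ↭ c → δ y N * vandermonde N ys ≈ 0#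
    term≈0 y ys p with y ℕ.≟ N | All-resp-↭ (↭-sym p) c≥1
    ... | no  y≢N    | _           = δ-≢-* y≢N _
    ... | yes ≡.refl | y≥1 ∷ ys≥1 = trans (*-congˡ (vandermonde-positive y ys y≥1 ys≥1)) (zeroʳ _)

  vandermonde-↭upTo : ∀ N c → c ↭ upTo N → ∃[ k ] vandermonde N c ≈ sign k
  vandermonde-↭upTo zero    c c↭[] with ↭-empty-inv c↭[]
  ... | ≡.refl = 0 , refl
  vandermonde-↭upTo (suc N) c c↭ with ∈-∃++ (∈-resp-↭ (↭-sym c↭) (∈-upTo⁺ (ℕ.n<1+n N)))
  ... | pre , suf , ≡.refl = j ℕ.+ k , (begin
    vandermonde (suc N) (pre ++ N ∷ suf)            ≈⟨ picked ⟩
    sign j * (δ N N * vandermonde N (pre ++ suf))   ≈⟨ *-congˡ (*-cong (reflexive (δ-refl N)) rest) ⟩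
    sign j * (1# * sign k)                          ≈⟨ *-congˡ (*-identityˡ _) ⟩
    sign j * sign k                                 ≈⟨ sign-+ j k ⟨
    sign (j ℕ.+ k)                                  ∎)
    where
    rest↭ : pre ++ suf ↭ upTo N
    rest↭ = ≡.subst (pre ++ suf ↭_) (Listₚ.++-identityʳ _)
              (drop-mid pre (upTo N) (≡.subst (pre ++ [ N ] ++ suf ↭_) (≡.sym (Listₚ.upTo-∷ʳ N)) c↭))
    rest≢N : All (_≢ N) (pre ++ suf)
    rest≢N = All.map (λ x<N x≡N → ℕ.<-irrefl x≡N x<N) (All-resp-↭ (↭-sym rest↭) (All.tabulate ∈-upTo⁻))
    single = alternate-single (λ y ys → δ y N * vandermonde N ys) N pre suf
               (++⁻ˡ pre rest≢N) (++⁻ʳ pre rest≢N) (λ y ys y≢N → δ-≢-* y≢N _)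
    j = proj₁ single
    picked = proj₂ single
    IH = vandermonde-↭upTo N (pre ++ suf) rest↭
    k = proj₁ IH
    rest = proj₂ IH

  -- shifts f b = ∑_{S} f (b + 1_S) over all sets S of positions of b, i.e. the functional f
  -- applied to ∏ᵢ (1 + zᵢ) · z^b; shiftsOfSize j restricts to |S| = j, i.e. to eⱼ(z) · z^b.
  shifts : (List ℕ → Carrier) → List ℕ → Carrier
  shifts f []       = f []
  shifts f (x ∷ xs) = shifts (λ ys → f (suc x ∷ ys)) xs + shifts (λ ys → f (x ∷ ys)) xs

  shiftsOfSize : ℕ → (List ℕ → Carrier) → List ℕ → Carrier
  shiftsOfSize zero    f []       = f []
  shiftsOfSize (suc j) f []       = 0#
  shiftsOfSize zero    f (x ∷ xs) = shiftsOfSize zero (λ ys → f (x ∷ ys)) xs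
  shiftsOfSize (suc j) f (x ∷ xs) =
    shiftsOfSize j (λ ys → f (suc x ∷ ys)) xs + shiftsOfSize (suc j) (λ ys → f (x ∷ ys)) xs

  shifts-+ : ∀ f g b → shifts (λ c → f c + g c) b ≈ shifts f b + shifts g b
  shifts-+ f g []       = refl
  shifts-+ f g (x ∷ xs) = trans (+-cong (shifts-+ _ _ xs) (shifts-+ _ _ xs)) (+-interchange _ _ _ _)

  shifts-neg : ∀ f b → shifts (λ c → - f c) b ≈ - shifts f b
  shifts-neg f []       = refl
  shifts-neg f (x ∷ xs) = trans (+-cong (shifts-neg _ xs) (shifts-neg _ xs)) (-‿+-comm _ _)

  shifts-− : ∀ f g b → shifts (λ c → f c - g c) b ≈ shifts f b - shifts g b
  shifts-− f g b = trans (shifts-+ f _ b) (+-congˡ (shifts-neg g b))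

  shifts-*ˡ : ∀ a f b → shifts (λ c → a * f c) b ≈ a * shifts f b
  shifts-*ˡ a f []       = refl
  shifts-*ˡ a f (x ∷ xs) = trans (+-cong (shifts-*ˡ a _ xs) (shifts-*ˡ a _ xs)) (sym (distribˡ a _ _))

  shifts-zero : ∀ f b → (∀ c → f c ≈ 0#) → shifts f b ≈ 0#
  shifts-zero f []       f≈0 = f≈0 []
  shifts-zero f (x ∷ xs) f≈0 =
    trans (+-cong (shifts-zero _ xs λ c → f≈0 _) (shifts-zero _ xs λ c → f≈0 _)) (+-identityˡ 0#)

  shifts-alternate : ∀ g c → shifts (alternate g) c ≈ alternate (λ y ys → shifts (g y) ys + shifts (g (suc y)) ys) c
  shifts-alternate g []       = refl
  shifts-alternate g (x ∷ xs) = begin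
    shifts (λ ys → g (suc x) ys - alternate g₁ ys) xs + shifts (λ ys → g x ys - alternate g₀ ys) xs
      ≈⟨ +-cong (shifts-− _ _ xs) (shifts-− _ _ xs) ⟩
    (shifts (g (suc x)) xs - shifts (alternate g₁) xs) + (shifts (g x) xs - shifts (alternate g₀) xs)
      ≈⟨ +-cong (−-cong refl (shifts-alternate g₁ xs)) (−-cong refl (shifts-alternate g₀ xs)) ⟩
    (shifts (g (suc x)) xs - alternate (G g₁) xs) + (shifts (g x) xs - alternate (G g₀) xs)
      ≈⟨ +-comm _ _ ⟩
    (shifts (g x) xs - alternate (G g₀) xs) + (shifts (g (suc x)) xs - alternate (G g₁) xs)
      ≈⟨ −-+-interchange _ _ _ _ ⟩
    (shifts (g x) xs + shifts (g (suc x)) xs) - (alternate (G g₀) xs + alternate (G g₁) xs)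
      ≈⟨ −-cong refl (trans (sym (alternate-+ (G g₀) (G g₁) xs)) (alternate-cong xs regroup)) ⟩
    (shifts (g x) xs + shifts (g (suc x)) xs) - alternate (λ y ys → G g y (x ∷ ys)) xs ∎
    where
    g₁ g₀ : ℕ → List ℕ → Carrier
    g₁ y ys = g y (suc x ∷ ys)
    g₀ y ys = g y (x ∷ ys)
    G : (ℕ → List ℕ → Carrier) → ℕ → List ℕ → Carrier
    G h y ys = shifts (h y) ys + shifts (h (suc y)) ys
    regroup : ∀ y ys → G g₀ y ys + G g₁ y ys ≈ G g y (x ∷ ys)
    regroup y ys = trans (+-interchange _ _ _ _) (+-cong (+-comm _ _) (+-comm _ _))

  -- The terms in which the picked entry was raised form an alternating double sum of a
  -- symmetric kernel, which vanishes.
  shifts-vandermonde : ∀ N c → shifts (vandermonde N) c ≈ vandermonde N c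
  shifts-vandermonde zero    []       = refl
  shifts-vandermonde zero    (x ∷ xs) = trans (+-cong (shifts-zero _ xs λ _ → refl) (shifts-zero _ xs λ _ → refl))
                                              (+-identityˡ 0#)
  shifts-vandermonde (suc N) c = begin
    shifts (alternate g) c
      ≈⟨ shifts-alternate g c ⟩
    alternate (λ y ys → shifts (g y) ys + shifts (g (suc y)) ys) c
      ≈⟨ alternate-cong c (λ y ys → +-cong (inner y ys) (inner (suc y) ys)) ⟩
    alternate (λ y ys → g y ys + g (suc y) ys) c
      ≈⟨ alternate-+ g (g ∘ suc) c ⟩
    alternate g c + alternate (g ∘ suc) c
      ≈⟨ +-congˡ (vanish N) ⟩
    alternate g c + 0#
      ≈⟨ +-identityʳ _ ⟩
    vandermonde (suc N) c ∎
    where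
    g : ℕ → List ℕ → Carrier
    g y ys = δ y N * vandermonde N ys
    inner : ∀ y ys → shifts (g y) ys ≈ g y ys
    inner y ys = trans (shifts-*ˡ _ _ ys) (*-congˡ (shifts-vandermonde N ys))
    vanish : ∀ N → alternate (λ y ys → δ (suc y) N * vandermonde N ys) c ≈ 0#
    vanish zero      = alternate-zero {Q = λ _ → ⊤} _ c (All.universal _ c) (λ y ys _ → zeroˡ _)
    vanish (suc N′)  = begin
      alternate (λ y ys → δ y N′ * alternate (λ z zs → δ z N′ * vandermonde N′ zs) ys) c
        ≈⟨ alternate-cong c (λ y ys → sym (alternate-*ˡ _ _ ys)) ⟩
      alternate (λ y ys → alternate (λ z zs → δ y N′ * (δ z N′ * vandermonde N′ zs)) ys) c
        ≈⟨ alternate²-symmetric _ (λ y z zs → *-lcomm _ _ _) c ⟩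
      0# ∎

  private
    cons-≡ : ∀ x {s t} j → s ≡ t ℕ.+ j → x ℕ.+ s ≡ x ℕ.+ t ℕ.+ j
    cons-≡ x j s≡ = ≡.trans (≡.cong (x ℕ.+_) s≡) (≡.sym (ℕ.+-assoc x _ j))

    cons-≡⁻ : ∀ x {s t} j → x ℕ.+ s ≡ x ℕ.+ t ℕ.+ j → s ≡ t ℕ.+ j
    cons-≡⁻ x j e = ℕ.+-cancelˡ-≡ x _ _ (≡.trans e (ℕ.+-assoc x _ j))

    suc-cons-≡ : ∀ x {s t} j → s ≡ t ℕ.+ j → suc (x ℕ.+ s) ≡ x ℕ.+ t ℕ.+ suc j
    suc-cons-≡ x j s≡ = ≡.trans (≡.cong suc (cons-≡ x j s≡)) (≡.sym (ℕ.+-suc _ j))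

    suc-cons-≡⁻ : ∀ x {s t} j → suc (x ℕ.+ s) ≡ x ℕ.+ t ℕ.+ suc j → s ≡ t ℕ.+ j
    suc-cons-≡⁻ x j e = cons-≡⁻ x j (ℕ.suc-injective (≡.trans e (ℕ.+-suc _ j)))

  shifts-vanish : ∀ f b → (∀ c → sum b ≤ sum c → f c ≈ 0#) → shifts f b ≈ 0#
  shifts-vanish f []       f≈0 = f≈0 [] ℕ.≤-refl
  shifts-vanish f (x ∷ xs) f≈0 =
    trans (+-cong (shifts-vanish _ xs λ c ≤c → f≈0 (suc x ∷ c) (ℕ.m≤n⇒m≤1+n (ℕ.+-monoʳ-≤ x ≤c)))
                  (shifts-vanish _ xs λ c ≤c → f≈0 (x ∷ c) (ℕ.+-monoʳ-≤ x ≤c)))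
          (+-identityˡ 0#)

  shiftsOfSize-vanish : ∀ j f b → (∀ c → sum c ≡ sum b ℕ.+ j → f c ≈ 0#) → shiftsOfSize j f b ≈ 0#
  shiftsOfSize-vanish zero    f []       f≈0 = f≈0 [] ≡.refl
  shiftsOfSize-vanish (suc j) f []       f≈0 = refl
  shiftsOfSize-vanish zero    f (x ∷ xs) f≈0 = shiftsOfSize-vanish zero _ xs λ c e → f≈0 (x ∷ c) (cons-≡ x 0 e)
  shiftsOfSize-vanish (suc j) f (x ∷ xs) f≈0 =
    trans (+-cong (shiftsOfSize-vanish j _ xs λ c e → f≈0 (suc x ∷ c) (suc-cons-≡ x j e))
                  (shiftsOfSize-vanish (suc j) _ xs λ c e → f≈0 (x ∷ c) (cons-≡ x (suc j) e)))
          (+-identityˡ 0#)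

  shiftsOfSize≈shifts : ∀ j f b → (∀ c → sum c ≢ sum b ℕ.+ j → f c ≈ 0#) → shiftsOfSize j f b ≈ shifts f b
  shiftsOfSize≈shifts zero    f []       f≈0 = refl
  shiftsOfSize≈shifts (suc j) f []       f≈0 = sym (f≈0 [] λ ())
  shiftsOfSize≈shifts zero    f (x ∷ xs) f≈0 = begin
    shiftsOfSize zero (λ ys → f (x ∷ ys)) xs
      ≈⟨ shiftsOfSize≈shifts zero _ xs (λ c c≢ → f≈0 (x ∷ c) (c≢ ∘ cons-≡⁻ x 0)) ⟩
    shifts (λ ys → f (x ∷ ys)) xs
      ≈⟨ +-identityˡ _ ⟨
    0# + shifts (λ ys → f (x ∷ ys)) xs
      ≈⟨ +-congʳ (shifts-vanish _ xs λ c ≤c → f≈0 (suc x ∷ c) (too-big ≤c)) ⟨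
    shifts (λ ys → f (suc x ∷ ys)) xs + shifts (λ ys → f (x ∷ ys)) xs ∎
    where
    too-big : ∀ {s t} → t ≤ s → suc (x ℕ.+ s) ≢ x ℕ.+ t ℕ.+ 0
    too-big t≤s e = ℕ.<-irrefl (≡.sym e) (ℕ.≤-trans (ℕ.≤-reflexive (ℕ.+-identityʳ _)) (s≤s (ℕ.+-monoʳ-≤ x t≤s)))
  shiftsOfSize≈shifts (suc j) f (x ∷ xs) f≈0 =
    +-cong (shiftsOfSize≈shifts j _ xs λ c c≢ → f≈0 (suc x ∷ c) (c≢ ∘ suc-cons-≡⁻ x j))
           (shiftsOfSize≈shifts (suc j) _ xs λ c c≢ → f≈0 (x ∷ c) (c≢ ∘ cons-≡⁻ x (suc j)))

  -- By homogeneity only subsets of size j + 1 contribute to the full sum over all subsets,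
  -- which is vandermonde N b by shifts-vandermonde, and that vanishes by homogeneity again.
  shiftsOfSize-vandermonde : ∀ N j b → shiftsOfSize (suc j) (vandermonde N) b ≈ 0#
  shiftsOfSize-vandermonde N j b with sum b ℕ.+ suc j ℕ.≟ triangular N
  ... | no  b+j≢ = shiftsOfSize-vanish (suc j) (vandermonde N) b
                     λ c e → vandermonde-homogeneous N c (b+j≢ ∘ ≡.trans (≡.sym e))
  ... | yes b+j≡ = begin
    shiftsOfSize (suc j) (vandermonde N) b
      ≈⟨ shiftsOfSize≈shifts (suc j) (vandermonde N) b
           (λ c c≢ → vandermonde-homogeneous N c (c≢ ∘ flip ≡.trans (≡.sym b+j≡))) ⟩
    shifts (vandermonde N) b
      ≈⟨ shifts-vandermonde N b ⟩
    vandermonde N b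
      ≈⟨ vandermonde-homogeneous N b (λ b≡ → ℕ.m≢1+m+n (sum b) (≡.trans b≡ (≡.trans (≡.sym b+j≡) (ℕ.+-suc _ j)))) ⟩
    0# ∎

module SubsetSums {c ℓ} (K : CommutativeRing c ℓ) (n : ℕ) where
  open import Data.Bool using (true; false)
  open CommutativeRing K hiding (zero)
  open Poly K n using (sublists)
  open Sums +-commutativeMonoid
  open Vandermonde K
  open import Relation.Binary.Reasoning.Setoid setoid

  ofSize : ∀ {a} {A : Set a} → ℕ → List (List A) → List (List A)
  ofSize j = filter (λ S → length S ℕ.≟ j)

  sublists-map : ∀ {a b} {A : Set a} {B : Set b} (f : A → B) (L : List A) →
                 sublists (map f L) ≡ map (map f) (sublists L)
  sublists-map f []      = ≡.refl
  sublists-map f (z ∷ L) rewrite sublists-map f L =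
    ≡.sym (≡.trans (Listₚ.map-++ (map f) (map (z ∷_) S) S)
                   (≡.cong (_++ map (map f) S) (≡.trans (≡.sym (Listₚ.map-∘ S)) (Listₚ.map-∘ S))))
    where S = sublists L

  module _ {a} {A : Set a} (ψ : List A → Carrier) where

    ∑-ofSize-∷ : ∀ z j Y → ∑ ψ (ofSize (suc j) (map (z ∷_) Y)) ≡ ∑ (ψ ∘ (z ∷_)) (ofSize j Y)
    ∑-ofSize-∷ z j []      = ≡.refl
    ∑-ofSize-∷ z j (S ∷ Y) with length S ℕ.≡ᵇ j
    ... | true  = ≡.cong (ψ (z ∷ S) +_) (∑-ofSize-∷ z j Y)
    ... | false = ∑-ofSize-∷ z j Y

    ∑-ofSize-zero-∷ : ∀ z Y → ∑ ψ (ofSize 0 (map (z ∷_) Y)) ≡ 0#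
    ∑-ofSize-zero-∷ z []      = ≡.refl
    ∑-ofSize-zero-∷ z (S ∷ Y) = ∑-ofSize-zero-∷ z Y

    ∑-ofSize-map : ∀ {b} {B : Set b} (f : B → A) j Y → ∑ ψ (ofSize j (map (map f) Y)) ≡ ∑ (ψ ∘ map f) (ofSize j Y)
    ∑-ofSize-map f j []      = ≡.refl
    ∑-ofSize-map f j (S ∷ Y) rewrite Listₚ.length-map f S with length S ℕ.≡ᵇ j
    ... | true  = ≡.cong (ψ (map f S) +_) (∑-ofSize-map f j Y)
    ... | false = ∑-ofSize-map f j Y

  shiftsOfSizeV : ∀ {m} → ℕ → (Vec ℕ m → Carrier) → Vec ℕ m → Carrier
  shiftsOfSizeV zero    f []       = f []
  shiftsOfSizeV (suc j) f []       = 0#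
  shiftsOfSizeV zero    f (x ∷ xs) = shiftsOfSizeV zero (λ ys → f (x ∷ ys)) xs
  shiftsOfSizeV (suc j) f (x ∷ xs) =
    shiftsOfSizeV j (λ ys → f (suc x ∷ ys)) xs + shiftsOfSizeV (suc j) (λ ys → f (x ∷ ys)) xs

  shiftsOfSizeV-zero : ∀ {m} j (f : Vec ℕ m → Carrier) b → (∀ v → f v ≈ 0#) → shiftsOfSizeV j f b ≈ 0#
  shiftsOfSizeV-zero zero    f []       f≈0 = f≈0 []
  shiftsOfSizeV-zero (suc j) f []       f≈0 = refl
  shiftsOfSizeV-zero zero    f (x ∷ xs) f≈0 = shiftsOfSizeV-zero zero _ xs λ v → f≈0 _
  shiftsOfSizeV-zero (suc j) f (x ∷ xs) f≈0 =
    trans (+-cong (shiftsOfSizeV-zero j _ xs λ v → f≈0 _) (shiftsOfSizeV-zero (suc j) _ xs λ v → f≈0 _))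
          (+-identityˡ 0#)

  shiftsOfSizeV-*ˡ : ∀ {m} j a (f : Vec ℕ m → Carrier) b → shiftsOfSizeV j (λ v → a * f v) b ≈ a * shiftsOfSizeV j f b
  shiftsOfSizeV-*ˡ zero    a f []       = refl
  shiftsOfSizeV-*ˡ (suc j) a f []       = sym (zeroʳ a)
  shiftsOfSizeV-*ˡ zero    a f (x ∷ xs) = shiftsOfSizeV-*ˡ zero a _ xs
  shiftsOfSizeV-*ˡ (suc j) a f (x ∷ xs) =
    trans (+-cong (shiftsOfSizeV-*ˡ j a _ xs) (shiftsOfSizeV-*ˡ (suc j) a _ xs)) (sym (distribˡ a _ _))

  shiftsOfSizeV-toList : ∀ {m} j (f : List ℕ → Carrier) (b w : Vec ℕ m) →
                         shiftsOfSizeV j (λ v → f (toList (v ⊞ w))) b ≈ shiftsOfSize j f (toList (b ⊞ w))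
  shiftsOfSizeV-toList zero    f []       []       = refl
  shiftsOfSizeV-toList (suc j) f []       []       = refl
  shiftsOfSizeV-toList zero    f (x ∷ xs) (y ∷ ys) = shiftsOfSizeV-toList zero _ xs ys
  shiftsOfSizeV-toList (suc j) f (x ∷ xs) (y ∷ ys) =
    +-cong (shiftsOfSizeV-toList j _ xs ys) (shiftsOfSizeV-toList (suc j) _ xs ys)

  ∑-ofSize-sublists : ∀ m (φ : Vec ℕ m → Carrier) α j →
                      ∑ (λ S → φ (α ⊞ indicator S)) (ofSize j (sublists (allFin m))) ≈ shiftsOfSizeV j φ α
  ∑-ofSize-sublists zero    φ [] zero    = +-identityʳ _
  ∑-ofSize-sublists zero    φ [] (suc j) = refl
  ∑-ofSize-sublists (suc m) φ (a ∷ α) j = begin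
    ∑ ψ (ofSize j (map (Fin.zero ∷_) Y ++ Y))
      ≈⟨ reflexive (≡.cong (∑ ψ) (Listₚ.filter-++ _ (map (Fin.zero ∷_) Y) Y)) ⟩
    ∑ ψ (ofSize j (map (Fin.zero ∷_) Y) ++ ofSize j Y)
      ≈⟨ ∑-++ ψ (ofSize j (map (Fin.zero ∷_) Y)) (ofSize j Y) ⟩
    ∑ ψ (ofSize j (map (Fin.zero ∷_) Y)) + ∑ ψ (ofSize j Y)
      ≈⟨ split j ⟩
    shiftsOfSizeV j φ (a ∷ α) ∎
    where
    ψ : List (Fin (suc m)) → Carrier
    ψ S = φ ((a ∷ α) ⊞ indicator S)
    subsets : ℕ → List (List (Fin m))
    subsets j = ofSize j (sublists (allFin m))
    Y = sublists (List.tabulate {n = m} Fin.suc)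
    Y≡ : Y ≡ map (map Fin.suc) (sublists (allFin m))
    Y≡ = ≡.trans (≡.cong sublists (≡.sym (Listₚ.map-tabulate (λ i → i) Fin.suc)))
                 (sublists-map Fin.suc (allFin m))
    without₀ : ∀ j → ∑ ψ (ofSize j Y) ≈ shiftsOfSizeV j (λ v → φ (a ∷ v)) α
    without₀ j = begin
      ∑ ψ (ofSize j Y)
        ≈⟨ reflexive (≡.trans (≡.cong (∑ ψ ∘ ofSize j) Y≡) (∑-ofSize-map ψ Fin.suc j (sublists (allFin m)))) ⟩
      ∑ (ψ ∘ map Fin.suc) (ofSize j (sublists (allFin m)))
        ≈⟨ ∑-cong (subsets j) (λ S → reflexive (≡.cong φ (∷-⊞-indicator-map-suc a α S))) ⟩
      ∑ (λ S → φ (a ∷ α ⊞ indicator S)) (ofSize j (sublists (allFin m)))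
        ≈⟨ ∑-ofSize-sublists m (λ v → φ (a ∷ v)) α j ⟩
      shiftsOfSizeV j (λ v → φ (a ∷ v)) α ∎
    with₀ : ∀ j → ∑ ψ (ofSize (suc j) (map (Fin.zero ∷_) Y)) ≈ shiftsOfSizeV j (λ v → φ (suc a ∷ v)) α
    with₀ j = begin
      ∑ ψ (ofSize (suc j) (map (Fin.zero ∷_) Y))
        ≈⟨ reflexive (≡.trans (∑-ofSize-∷ ψ Fin.zero j Y)
                              (≡.trans (≡.cong (∑ (ψ ∘ (Fin.zero ∷_)) ∘ ofSize j) Y≡)
                                       (∑-ofSize-map (ψ ∘ (Fin.zero ∷_)) Fin.suc j (sublists (allFin m))))) ⟩
      ∑ (ψ ∘ (Fin.zero ∷_) ∘ map Fin.suc) (ofSize j (sublists (allFin m)))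
        ≈⟨ ∑-cong (subsets j) (λ S → reflexive (≡.cong φ (∷-⊞-indicator-zero∷map-suc a α S))) ⟩
      ∑ (λ S → φ (suc a ∷ α ⊞ indicator S)) (ofSize j (sublists (allFin m)))
        ≈⟨ ∑-ofSize-sublists m (λ v → φ (suc a ∷ v)) α j ⟩
      shiftsOfSizeV j (λ v → φ (suc a ∷ v)) α ∎
    split : ∀ j → ∑ ψ (ofSize j (map (Fin.zero ∷_) Y)) + ∑ ψ (ofSize j Y) ≈ shiftsOfSizeV j φ (a ∷ α)
    split zero    = trans (+-cong (reflexive (∑-ofSize-zero-∷ ψ Fin.zero Y)) (without₀ zero)) (+-identityˡ _)
    split (suc j) = +-cong (with₀ j) (without₀ (suc j))

module Ranges {c ℓ} (K : CommutativeRing c ℓ) (n : ℕ) where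
  open import Relation.Unary using (Decidable)
  open import Data.List.Membership.Propositional.Properties using (∈-filter⁺; ∈-allFin)
  open import Data.List.Relation.Unary.All.Properties using (all-filter)
  import Data.List.Relation.Unary.Unique.Propositional.Properties as Unique
  open Poly K n using (range)

  InRange : ℕ → ℕ → Fin n → Set
  InRange a b i = a ≤ suc (toℕ i) × suc (toℕ i) ≤ b

  inRange? : ∀ a b → Decidable (InRange a b)
  inRange? a b i = (a ≤? suc (toℕ i)) ×-dec (suc (toℕ i) ≤? b)

  range-unique : ∀ a b → Unique (range a b)
  range-unique a b = Unique.filter⁺ (inRange? a b) (Unique.allFin⁺ n)

  ∈-range : ∀ {a b i} → InRange a b i → i ∈ range a b
  ∈-range {a} {b} {i} = ∈-filter⁺ (inRange? a b) (∈-allFin i)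

  range-inRange : ∀ a b → All (InRange a b) (range a b)
  range-inRange a b = all-filter (inRange? a b) (allFin n)

module FirstVariable {c ℓ} (K : CommutativeRing c ℓ) (N : ℕ) where
  open CommutativeRing K hiding (zero)
  open import Relation.Binary.Reasoning.Setoid setoid
  open Poly K (suc N)
  open LinearExtension K (suc N)
  open Terms K (suc N)
  open Alternating K using (sign)
  open Ranges K (suc N)

  KillsX₁ : (Mon (suc N) → Carrier) → Set ℓ
  KillsX₁ F = ∀ α β → 1 ≤ lookup α Fin.zero → F (α , β) ≈ 0#

  killsX₁-mulMon : ∀ {F} → KillsX₁ F → ∀ α₀ β₀ α β → 1 ≤ lookup α₀ Fin.zero ℕ.+ lookup α Fin.zero →
                   F (mulMon (α₀ , β₀) (α , β)) ≈ 0#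
  killsX₁-mulMon F-x₁ α₀ β₀ α β 1≤ = F-x₁ _ _ (≡.subst (1 ≤_) (≡.sym (lookup-⊞ α₀ α Fin.zero)) 1≤)

  killsX₁-shift : ∀ {F} m → KillsX₁ F → KillsX₁ (F ∘ mulMon m)
  killsX₁-shift (α₀ , β₀) F-x₁ α β 1≤α = killsX₁-mulMon F-x₁ α₀ β₀ α β (ℕ.≤-trans 1≤α (ℕ.m≤n+m _ _))

  extend-Π-x₁-minus : ∀ {F} → KillsX₁ F → ∀ R →
                      extend F (ΠP (map (λ l → X 1 ⊝ x l) R)) ≈ sign (length R) * F (xMon (indicator R))
  extend-Π-x₁-minus F-x₁ []      = +-identityʳ _
  extend-Π-x₁-minus {F} F-x₁ (l ∷ R) = begin
    extend F ((X 1 ⊝ x l) ⊛ Q)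
      ≈⟨ extend-⊛ F (X 1 ⊝ x l) Q ⟩
    1# * G (xMon (unit Fin.zero)) + (- 1# * G (xMon (unit l)) + 0#)
      ≈⟨ +-cong (trans (*-congˡ (extend-zero _ Q λ (α , β) → killsX₁-mulMon F-x₁ (unit Fin.zero) 0⃗ α β (s≤s z≤n)))
                       (zeroʳ 1#))
                (+-identityʳ _) ⟩
    0# + - 1# * G (xMon (unit l))
      ≈⟨ +-identityˡ _ ⟩
    - 1# * G (xMon (unit l))
      ≈⟨ *-congˡ (extend-Π-x₁-minus (killsX₁-shift (xMon (unit l)) F-x₁) R) ⟩
    - 1# * (sign (length R) * F (mulMon (xMon (unit l)) (xMon (indicator R))))
      ≈⟨ *-assoc _ _ _ ⟨
    sign (length (l ∷ R)) * F (mulMon (xMon (unit l)) (xMon (indicator R)))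
      ≡⟨ ≡.cong (λ m → sign (length (l ∷ R)) * F m) (mulMon-xMon (unit l) (indicator R)) ⟩
    sign (length (l ∷ R)) * F (xMon (indicator (l ∷ R))) ∎
    where
    Q = ΠP (map (λ l → X 1 ⊝ x l) R)
    G = λ u → extend (F ∘ mulMon u) Q

  indicator-range-x₁ : ∀ {a} b → 2 ≤ a → lookup (indicator (range a b)) Fin.zero ≡ 0
  indicator-range-x₁ {a} b 2≤a = lookup-indicator-∉ (range a b)
    (All.map (λ { (a≤1 , _) ≡.refl → ℕ.<-irrefl ≡.refl (ℕ.≤-trans 2≤a a≤1) }) (range-inRange a b))

module SeparatingFunctional {c ℓ} (K : CommutativeRing c ℓ) {N h₁ : ℕ}
                            (1≤h₁ : 1 ≤ h₁) (h₁≤n : h₁ ≤ suc N) (1≤N : 1 ≤ N) where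
  open CommutativeRing K hiding (zero)
  open import Algebra.Properties.CommutativeSemigroup *-commutativeSemigroup
    using () renaming (x∙yz≈y∙xz to *-lcomm)
  open import Algebra.Properties.Group +-group using ()
    renaming (//-cong₂ to −-cong; x≈y⇒x∙y⁻¹≈ε to x≈y⇒x−y≈0)
  open import Relation.Binary.Reasoning.Setoid setoid
  open Poly K (suc N)
  open LinearExtension K (suc N)
  open Terms K (suc N)
  open Ranges K (suc N)
  open FirstVariable K N
  open Sums +-commutativeMonoid
  open Vandermonde K
  open Alternating K
  open SubsetSums K (suc N)

  R₀ R₁ R₂ : List (Fin (suc N))
  R₀ = range 2 h₁
  R₁ = range (suc h₁) (suc N)
  R₂ = range 2 (suc N)

  σ : Carrier
  σ = sign (length R₀)

  p⃗ : Vec ℕ N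
  p⃗ = tail (indicator R₀)

  R₂-covers : ∀ i → 1 ≤ lookup (tail (indicator R₂)) i
  R₂-covers i = ≡.subst (1 ≤_) (≡.sym (lookup-tail (indicator R₂) i))
                  (lookup-indicator-∈ R₂ (∈-range (s≤s (s≤s z≤n) , s≤s (Finₚ.toℕ<n i))))

  R₀R₁-cover : ∀ i → 1 ≤ lookup p⃗ i ⊎ 1 ≤ lookup (tail (indicator R₁)) i
  R₀R₁-cover i with suc (suc (toℕ i)) ≤? h₁
  ... | yes ≤h₁ = inj₁ (≡.subst (1 ≤_) (≡.sym (lookup-tail (indicator R₀) i))
                          (lookup-indicator-∈ R₀ (∈-range (s≤s (s≤s z≤n) , ≤h₁))))
  ... | no  ≰h₁ = inj₂ (≡.subst (1 ≤_) (≡.sym (lookup-tail (indicator R₁) i))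
                          (lookup-indicator-∈ R₁ (∈-range (ℕ.≰⇒> ≰h₁ , s≤s (Finₚ.toℕ<n i)))))

  offset : Vec ℕ N → ℕ → Vec ℕ N
  offset g zero    = g
  offset g (suc c) = p⃗ ⊞ offset g c

  weight : Fin (suc N) → ℕ → Vec ℕ (suc N) → Carrier
  weight k a β = δ a 0 * δ (Vec.sum β) (lookup β k) * pow K σ (lookup β k)

  weight-y : ∀ k a β → weight k a (β ⊞ unit k) ≈ σ * weight k a β
  weight-y k a β rewrite lookup-⊞-unit β k | sum-⊞-unit β k = *-lcomm _ σ _

  module _ (k : Fin (suc N)) (g : Vec ℕ N) where

    -- Φ is f ↦ ⟨Δ, z^g · ρ f⟩ for the ring map ρ : x₁ ↦ 0, (x₂, …, xₙ) ↦ z, y_j ↦ 0 (j ≠ k),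
    -- y_k ↦ σ z^p⃗ = ∏_{ℓ=2}^{h₁} (-x_ℓ), where ⟨Δ, z^c⟩ = vandermonde N c; here it is written out
    -- on the monomial x₁^a x^α y^β, so that ρ (x₁^a x^α y^β) = 0 unless a = 0 and β = c · e_k.
    Φ : Mon (suc N) → Carrier
    Φ (a ∷ α , β) = weight k a β * vandermonde N (toList (α ⊞ offset g (lookup β k)))

    Φ-eval : ∀ a α β {c} → lookup β k ≡ c → Φ (a ∷ α , β) ≡ weight k a β * vandermonde N (toList (α ⊞ offset g c))
    Φ-eval a α β ≡.refl = ≡.refl

    Φ-killsX₁ : KillsX₁ Φ
    Φ-killsX₁ (suc a ∷ α) β _ = trans (*-assoc _ _ _) (trans (*-assoc _ _ _) (zeroˡ _))

    Φ-y : ∀ α β → lookup β k < Vec.sum β → Φ (α , β) ≈ 0#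
    Φ-y (a ∷ α) β k<sum = trans (*-congʳ (trans (*-congʳ (trans (*-congˡ δ≡0) (zeroʳ _))) (zeroˡ _))) (zeroˡ _)
      where δ≡0 = reflexive (δ-≢ (λ sum≡ → ℕ.<-irrefl (≡.sym sum≡) k<sum))

    Φ-positive : ∀ a α β → (∀ i → 1 ≤ lookup (α ⊞ offset g (lookup β k)) i) → Φ (a ∷ α , β) ≈ 0#
    Φ-positive a α β 1≤ = trans (*-congˡ (vandermonde-positive N _ 1≤N (positive _ 1≤))) (zeroʳ _)
      where
      positive : ∀ {m} (v : Vec ℕ m) → (∀ i → 1 ≤ lookup v i) → All (1 ≤_) (toList v)
      positive []      _   = []
      positive (a ∷ v) 1≤v = 1≤v Fin.zero ∷ positive v (1≤v ∘ Fin.suc)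

    Φ⟨_⟩ : Mon (suc N) → Mon (suc N) → Carrier
    Φ⟨ m ⟩ = Φ ∘ mulMon m

    Φ⟨⟩-y : ∀ m α β → lookup β k < Vec.sum β → Φ⟨ m ⟩ (α , β) ≈ 0#
    Φ⟨⟩-y (α₀ , β₀) α β k<sum = Φ-y (α₀ ⊞ α) (β₀ ⊞ β) (≡.subst₂ _<_ (≡.sym (lookup-⊞ β₀ β k)) (≡.sym (sum-⊞ β₀ β))
                                                    (ℕ.+-mono-≤-< (lookup≤sum β₀ k) k<sum))

    unit-off : ∀ {j} → j ≢ k → lookup (unit j) k < Vec.sum (unit j)
    unit-off {j} j≢k = ≡.subst₂ _<_ (≡.sym (lookup-unit-≢ j≢k)) (≡.sym (sum-unit j)) (s≤s z≤n)

    Φ-y-off : ∀ α {j} → j ≢ k → Φ (α , unit j) ≈ 0#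
    Φ-y-off α j≢k = Φ-y α _ (unit-off j≢k)

    Φ⟨⟩-y-off : ∀ m α {j} → j ≢ k → Φ⟨ m ⟩ (α , unit j) ≈ 0#
    Φ⟨⟩-y-off m α j≢k = Φ⟨⟩-y m α _ (unit-off j≢k)

    Φ⟨⟩-yy : ∀ m {k₁ k₂} → k₁ ≢ k₂ → extend Φ⟨ m ⟩ (y k₁ ⊛ y k₂) ≈ 0#
    Φ⟨⟩-yy m {k₁} {k₂} k₁≢k₂ = begin
      extend Φ⟨ m ⟩ (y k₁ ⊛ y k₂)
        ≈⟨ isTerm-⊛ (y k₁) (y k₂) (isTerm-singleton _ _) (isTerm-singleton _ _) Φ⟨ m ⟩ ⟩
      1# * 1# * Φ⟨ m ⟩ (0⃗ ⊞ 0⃗ , unit k₁ ⊞ unit k₂)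
        ≈⟨ *-congˡ (Φ⟨⟩-y m _ _ k<2) ⟩
      1# * 1# * 0#
        ≈⟨ zeroʳ _ ⟩
      0# ∎
      where
      at-most-one : lookup (unit k₁) k ℕ.+ lookup (unit k₂) k ≤ 1
      at-most-one with k₁ Finₚ.≟ k
      ... | yes ≡.refl = ≡.subst (λ b → lookup (unit k₁) k₁ ℕ.+ b ≤ 1) (≡.sym (lookup-unit-≢ (k₁≢k₂ ∘ ≡.sym)))
                                 (ℕ.≤-trans (ℕ.≤-reflexive (ℕ.+-identityʳ _)) (lookup-unit-≤1 k₁ k₁))
      ... | no  k₁≢k   = ≡.subst (λ b → b ℕ.+ lookup (unit k₂) k ≤ 1) (≡.sym (lookup-unit-≢ k₁≢k))
                                 (lookup-unit-≤1 k₂ k)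
      k<2 : lookup (unit k₁ ⊞ unit k₂) k < Vec.sum (unit k₁ ⊞ unit k₂)
      k<2 = ≡.subst₂ _<_ (≡.sym (lookup-⊞ (unit k₁) (unit k₂) k))
                         (≡.sym (≡.trans (sum-⊞ (unit k₁) (unit k₂)) (≡.cong₂ ℕ._+_ (sum-unit k₁) (sum-unit k₂))))
                         (s≤s at-most-one)

    Φ⟨⟩-x₁y : ∀ m j → extend Φ⟨ m ⟩ (X 1 ⊛ y j) ≈ 0#
    Φ⟨⟩-x₁y m j = trans (isTerm-⊛ (X 1) (y j) (isTerm-singleton _ _) (isTerm-singleton _ _) Φ⟨ m ⟩)
                        (trans (*-congˡ (killsX₁-shift m Φ-killsX₁ _ _ (s≤s z≤n))) (zeroʳ _))

    extend-∑y : ∀ m → extend Φ⟨ m ⟩ (ΣP (map y (allFin (suc N)))) ≈ Φ⟨ m ⟩ (yMon (unit k))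
    extend-∑y m = begin
      extend Φ⟨ m ⟩ (ΣP (map y (allFin (suc N))))
        ≈⟨ extend-ΣP Φ⟨ m ⟩ (map y (allFin (suc N))) ⟩
      ∑ (extend Φ⟨ m ⟩) (map y (allFin (suc N)))
        ≡⟨ ∑-map (extend Φ⟨ m ⟩) y (allFin (suc N)) ⟩
      ∑ (λ j → extend Φ⟨ m ⟩ (y j)) (allFin (suc N))
        ≈⟨ ∑-allFin-single _ k (λ j j≢k → trans (isTerm-singleton 1# (yMon (unit j)) Φ⟨ m ⟩)
                                                 (trans (*-congˡ (Φ⟨⟩-y-off m 0⃗ j≢k)) (zeroʳ 1#))) ⟩
      extend Φ⟨ m ⟩ (y k)
        ≈⟨ trans (isTerm-singleton 1# (yMon (unit k)) Φ⟨ m ⟩) (*-identityˡ _) ⟩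
      Φ⟨ m ⟩ (yMon (unit k)) ∎

    Φ⟨⟩-sum : ∀ a α β → extend Φ⟨ a ∷ α , β ⟩ (gen h₁ gsum) ≈ 0#
    Φ⟨⟩-sum a α β = begin
      extend F (A ⊝ B)         ≈⟨ extend-⊝ F A B ⟩
      extend F A - extend F B  ≈⟨ −-cong (extend-∑y m) (extend-Π-x₁-minus (killsX₁-shift m Φ-killsX₁) R₀) ⟩
      F (yMon (unit k)) - σ * F (xMon (indicator R₀)) ≈⟨ x≈y⇒x−y≈0 y≈σx ⟩
      0#                       ∎
      where
      m = a ∷ α , β
      F = Φ⟨ m ⟩
      A = ΣP (map y (allFin (suc N)))
      B = ΠRange 2 h₁ (λ l → X 1 ⊝ x l)
      V = λ v → vandermonde N (toList v)
      b = lookup β k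
      y≈σx : F (yMon (unit k)) ≈ σ * F (xMon (indicator R₀))
      y≈σx = begin
        F (yMon (unit k))
          ≡⟨ ≡.cong Φ (mulMon-yMonʳ (a ∷ α) β (unit k)) ⟩
        Φ (a ∷ α , β ⊞ unit k)
          ≡⟨ Φ-eval a α (β ⊞ unit k) (lookup-⊞-unit β k) ⟩
        weight k a (β ⊞ unit k) * V (α ⊞ (p⃗ ⊞ offset g b))
          ≈⟨ *-cong (weight-y k a β) (reflexive (≡.cong V (≡.sym (⊞-assoc α p⃗ _)))) ⟩
        σ * weight k a β * V (α ⊞ p⃗ ⊞ offset g b)
          ≈⟨ *-assoc _ _ _ ⟩
        σ * Φ (a ∷ α ⊞ p⃗ , β)
          ≡⟨ ≡.cong (λ m → σ * Φ m) (≡.trans (mulMon-xMonʳ (a ∷ α) β (indicator R₀))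
                                              (≡.cong (_, β) (∷-⊞ a α _ (indicator-range-x₁ h₁ (s≤s (s≤s z≤n)))))) ⟨
        σ * F (xMon (indicator R₀)) ∎

    Φ⟨⟩-rel : ∀ a α β j → extend Φ⟨ a ∷ α , β ⟩ (gen h₁ (grel j)) ≈ 0#
    Φ⟨⟩-rel a α β j = begin
      extend F ((A ⊛ y j) ⊝ B)
        ≈⟨ extend-⊝ F (A ⊛ y j) B ⟩
      extend F (A ⊛ y j) - extend F B
        ≈⟨ −-cong (isTerm-⊛ A (y j) (isTerm-Π⊖x R₁) (isTerm-singleton _ _) F) (isTerm-Π⊖x R₂ F) ⟩
      sign (length R₁) * 1# * F (mulMon (xMon I₁) (yMon (unit j))) - sign (length R₂) * F (xMon I₂)
        ≈⟨ −-cong (trans (*-congˡ (first-term (j Finₚ.≟ k))) (zeroʳ _)) (trans (*-congˡ second-term) (zeroʳ _)) ⟩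
      0# - 0#
        ≈⟨ -‿inverseʳ 0# ⟩
      0# ∎
      where
      m = a ∷ α , β
      F = Φ⟨ m ⟩
      A = ΠRange (suc h₁) (suc N) (λ l → ⊖ x l)
      B = ΠRange 2 (suc N) (λ l → ⊖ x l)
      I₁ = indicator R₁
      I₂ = indicator R₂
      b = lookup β k
      first-term : Dec (j ≡ k) → F (mulMon (xMon I₁) (yMon (unit j))) ≈ 0#
      first-term (no j≢k) = trans (reflexive (≡.cong F (mulMon-xMon-yMon I₁ (unit j)))) (Φ⟨⟩-y-off m I₁ j≢k)
      first-term (yes ≡.refl) = begin
        F (mulMon (xMon I₁) (yMon (unit k)))
          ≡⟨ ≡.cong F (mulMon-xMon-yMon I₁ (unit k)) ⟩
        Φ ((a ∷ α) ⊞ I₁ , β ⊞ unit k)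
          ≡⟨ ≡.cong (λ v → Φ (v , β ⊞ unit k)) (∷-⊞ a α I₁ (indicator-range-x₁ (suc N) (s≤s 1≤h₁))) ⟩
        Φ (a ∷ α ⊞ tail I₁ , β ⊞ unit k)
          ≈⟨ Φ-positive a (α ⊞ tail I₁) (β ⊞ unit k) covered ⟩
        0# ∎
        where
        covered : ∀ i → 1 ≤ lookup (α ⊞ tail I₁ ⊞ offset g (lookup (β ⊞ unit k) k)) i
        covered i rewrite lookup-⊞-unit β k with R₀R₁-cover i
        ... | inj₁ 1≤p = ℕ.≤-trans 1≤p (ℕ.≤-trans (lookup-≤-⊞ˡ p⃗ _ i) (lookup-≤-⊞ʳ (α ⊞ tail I₁) _ i))
        ... | inj₂ 1≤I = ℕ.≤-trans 1≤I (ℕ.≤-trans (lookup-≤-⊞ʳ α _ i) (lookup-≤-⊞ˡ (α ⊞ tail I₁) _ i))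
      second-term : F (xMon I₂) ≈ 0#
      second-term = begin
        F (xMon I₂)
          ≡⟨ ≡.cong Φ (≡.trans (mulMon-xMonʳ (a ∷ α) β I₂)
                               (≡.cong (_, β) (∷-⊞ a α I₂ (indicator-range-x₁ (suc N) (s≤s (s≤s z≤n)))))) ⟩
        Φ (a ∷ α ⊞ tail I₂ , β)
          ≈⟨ Φ-positive a _ β covered ⟩
        0# ∎
        where
        covered : ∀ i → 1 ≤ lookup (α ⊞ tail I₂ ⊞ offset g (lookup β k)) i
        covered i = ℕ.≤-trans (R₂-covers i) (ℕ.≤-trans (lookup-≤-⊞ʳ α _ i) (lookup-≤-⊞ˡ (α ⊞ tail I₂) _ i))

    Φ⟨⟩-esym : ∀ a α β i → extend Φ⟨ a ∷ α , β ⟩ (gen h₁ (gel i)) ≈ 0#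
    Φ⟨⟩-esym a α β i = begin
      extend F (esym j)
        ≈⟨ extend-ΣP F (map (λ S → ΠP (map x S)) L) ⟩
      ∑ (extend F) (map (λ S → ΠP (map x S)) L)
        ≡⟨ ∑-map (extend F) (λ S → ΠP (map x S)) L ⟩
      ∑ (λ S → extend F (ΠP (map x S))) L
        ≈⟨ ∑-cong L (λ S → trans (isTerm-Πx S F)
                                 (trans (*-identityˡ _)
                                        (reflexive (≡.cong Φ (mulMon-xMonʳ (a ∷ α) β (indicator S)))))) ⟩
      ∑ (λ S → φ ((a ∷ α) ⊞ indicator S)) L
        ≈⟨ ∑-ofSize-sublists (suc N) φ (a ∷ α) j ⟩
      shiftsOfSizeV (toℕ i) (λ v → φ (suc a ∷ v)) α + shiftsOfSizeV j (λ v → φ (a ∷ v)) α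
        ≈⟨ +-cong (shiftsOfSizeV-zero (toℕ i) _ α (λ v → Φ-killsX₁ (suc a ∷ v) β (s≤s z≤n)))
                  (shiftsOfSizeV-*ˡ j (weight k a β) _ α) ⟩
      0# + weight k a β * shiftsOfSizeV j (λ v → vandermonde N (toList (v ⊞ offset g b))) α
        ≈⟨ +-identityˡ _ ⟩
      weight k a β * shiftsOfSizeV j (λ v → vandermonde N (toList (v ⊞ offset g b))) α
        ≈⟨ *-congˡ (shiftsOfSizeV-toList j (vandermonde N) α (offset g b)) ⟩
      weight k a β * shiftsOfSize j (vandermonde N) (toList (α ⊞ offset g b))
        ≈⟨ *-congˡ (shiftsOfSize-vandermonde N (toℕ i) (toList (α ⊞ offset g b))) ⟩
      weight k a β * 0#
        ≈⟨ zeroʳ _ ⟩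
      0# ∎
      where
      F = Φ⟨ a ∷ α , β ⟩
      j = suc (toℕ i)
      b = lookup β k
      L = ofSize j (sublists (allFin (suc N)))
      φ : Vec ℕ (suc N) → Carrier
      φ v = Φ (v , β)

    Φ⟨⟩-gen : ∀ m r → extend Φ⟨ m ⟩ (gen h₁ r) ≈ 0#
    Φ⟨⟩-gen m           (gyy k₁ k₂ k₁≢k₂) = Φ⟨⟩-yy m k₁≢k₂
    Φ⟨⟩-gen m           (gxy j)           = Φ⟨⟩-x₁y m j
    Φ⟨⟩-gen (a ∷ α , β) (grel j)          = Φ⟨⟩-rel a α β j
    Φ⟨⟩-gen (a ∷ α , β) gsum              = Φ⟨⟩-sum a α β
    Φ⟨⟩-gen (a ∷ α , β) (gel i)           = Φ⟨⟩-esym a α β i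

    Φ-kills-I : ∀ {f} → InI h₁ f → extend Φ f ≈ 0#
    Φ-kills-I {f} (ts , f≃) = begin
      extend Φ f               ≈⟨ extend-resp-≃ Φ {f} {ΣP (map G ts)} f≃ ⟩
      extend Φ (ΣP (map G ts)) ≈⟨ extend-ΣP Φ (map G ts) ⟩
      ∑ (extend Φ) (map G ts)  ≡⟨ ∑-map (extend Φ) G ts ⟩
      ∑ (extend Φ ∘ G) ts      ≈⟨ ∑-zero′ _ ts (λ (q , r) → trans (extend-⊛ Φ q (gen h₁ r))
                                                                 (extend-zero _ q λ m → Φ⟨⟩-gen m r)) ⟩
      0#                       ∎
      where
      G : P × Gen → P
      G (q , r) = q ⊛ gen h₁ r

module Monomial {c ℓ} (K : CommutativeRing c ℓ) (N : ℕ) (l : Fin N → ℕ) where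
  open CommutativeRing K hiding (zero)
  open Poly K (suc N)
  open Terms K (suc N)
  open Sums *-commutativeMonoid using () renaming (∑-zero′ to ∏-one)
  open Sums ℕ.+-0-commutativeMonoid using () renaming (∑-zero′ to ∑ℕ-zero; ∑-allFin-single to ∑ℕ-allFin-single)

  X-suc : ∀ (i : Fin (suc N)) → X (suc (toℕ i)) ≡ x i
  X-suc i with toℕ i <? suc N
  ... | yes i<n = ≡.cong x (Finₚ.fromℕ<-toℕ i i<n)
  ... | no  i≮n = ⊥-elim (i≮n (Finₚ.toℕ<n i))

  X-opposite : ∀ (j : Fin N) → X (suc N ∸ toℕ j) ≡ x (Fin.suc (opposite j))
  X-opposite j = ≡.trans (≡.cong X index) (X-suc (Fin.suc (opposite j)))
    where
    index : suc N ∸ toℕ j ≡ suc (suc (toℕ (opposite j)))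
    index = begin
      suc N ∸ toℕ j            ≡⟨ ℕ.+-∸-assoc 1 (ℕ.<⇒≤ (Finₚ.toℕ<n j)) ⟩
      suc (N ∸ toℕ j)          ≡⟨ ≡.cong suc (ℕ.+-∸-assoc 1 (Finₚ.toℕ<n j)) ⟩
      suc (suc (N ∸ suc (toℕ j))) ≡⟨ ≡.cong (suc ∘ suc) (Finₚ.opposite-prop j) ⟨
      suc (suc (toℕ (opposite j))) ∎
      where open ≡.≡-Reasoning

  exponents : Vec ℕ (suc N)
  exponents = 0 ∷ tabulate (l ∘ opposite)

  isTerm-monoL : IsTerm (monoL l) 1# (xMon exponents)
  isTerm-monoL = isTerm-resp (monoL l) (∏-one _ (allFin N) (pow-1# ∘ l)) (≡.cong xMon (≗⇒≡ entry))
                             (isTerm-ΠP (λ j → X (suc N ∸ toℕ j) ^P l j) factor (allFin N))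
    where
    factor : ∀ j → IsTerm (X (suc N ∸ toℕ j) ^P l j) (pow K 1# (l j)) (xMon (l j ·⃗ unit (Fin.suc (opposite j))))
    factor j rewrite X-opposite j = isTerm-^P (x (Fin.suc (opposite j))) (isTerm-singleton 1# _) (l j)
    v : Fin N → Vec ℕ (suc N)
    v j = l j ·⃗ unit (Fin.suc (opposite j))
    entry : ∀ t → lookup (∑⃗ v (allFin N)) t ≡ lookup exponents t
    entry Fin.zero    = ≡.trans (lookup-∑⃗ v (allFin N) Fin.zero)
                          (∑ℕ-zero _ (allFin N) λ j → ≡.trans (lookup-·⃗ (l j) _ Fin.zero) (ℕ.*-zeroʳ (l j)))
    entry (Fin.suc i) =
      ≡.trans (lookup-∑⃗ v (allFin N) (Fin.suc i)) (≡.trans (∑ℕ-allFin-single _ (opposite i) off) on)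
      where
      off : ∀ j → j ≢ opposite i → lookup (v j) (Fin.suc i) ≡ 0
      off j j≢ = ≡.trans (lookup-·⃗ (l j) _ (Fin.suc i))
                   (≡.trans (≡.cong (l j ℕ.*_) (lookup-unit-≢ (j≢ ∘ opposite-injective))) (ℕ.*-zeroʳ (l j)))
        where
        opposite-injective : opposite j ≡ i → j ≡ opposite i
        opposite-injective opp-j≡i = ≡.trans (≡.sym (Finₚ.opposite-involutive j)) (≡.cong opposite opp-j≡i)
      on : lookup (v (opposite i)) (Fin.suc i) ≡ lookup exponents (Fin.suc i)
      on rewrite lookup-·⃗ (l (opposite i)) (unit (Fin.suc (opposite (opposite i)))) (Fin.suc i)
               | Finₚ.opposite-involutive i | lookup-unit-≡ i | Vecₚ.lookup∘tabulate (l ∘ opposite) i =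
        ℕ.*-identityʳ _

  exponent-≤ : (∀ j → l j ≤ N ∸ suc (toℕ j)) → ∀ t → l (opposite t) ≤ toℕ t
  exponent-≤ l≤ t = ℕ.≤-trans (l≤ (opposite t))
                              (ℕ.≤-reflexive (≡.trans (≡.cong (λ o → N ∸ suc o) (Finₚ.opposite-prop t))
                                                      (∸-suc-∸-suc (Finₚ.toℕ<n t))))
    where
    ∸-suc-∸-suc : ∀ {s M} → s < M → M ∸ suc (M ∸ suc s) ≡ s
    ∸-suc-∸-suc (s≤s s≤M) = ℕ.m∸[m∸n]≡n s≤M

  module _ {h₁ : ℕ} (1≤h₁ : 1 ≤ h₁) where
    open Ranges K (suc N)
    open FirstVariable K N using (indicator-range-x₁)

    monoL-divisible : (∀ t → h₁ ≤ suc (toℕ t) → 1 ≤ l (opposite t)) → tailX h₁ ∣P monoL l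
    monoL-divisible covered = q , isTerm-≃ (monoL l) (q ⊛ tailX h₁) isTerm-monoL q⊛tailX
      where
      R₁ = range (suc h₁) (suc N)
      I₁ = indicator R₁
      d = Vec.zipWith _∸_ exponents I₁
      q : P
      q = (1# , xMon d) ∷ []
      I₁≤ : ∀ t → lookup I₁ t ≤ lookup exponents t
      I₁≤ Fin.zero    = ℕ.≤-reflexive (indicator-range-x₁ (suc N) (s≤s 1≤h₁))
      I₁≤ (Fin.suc i) with inRange? (suc h₁) (suc N) (Fin.suc i)
      ... | yes inR@(s≤s h₁≤ , _) =
        ℕ.≤-trans (lookup-indicator-≤1 (range-unique (suc h₁) (suc N)) (Fin.suc i))
                  (≡.subst (1 ≤_) (≡.sym (Vecₚ.lookup∘tabulate (l ∘ opposite) i)) (covered i h₁≤))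
      ... | no  ¬inR =
        ℕ.≤-trans (ℕ.≤-reflexive (lookup-indicator-∉ R₁ (All.map outside (range-inRange (suc h₁) (suc N))))) z≤n
        where
        outside : ∀ {j} → InRange (suc h₁) (suc N) j → j ≢ Fin.suc i
        outside inR j≡ = ¬inR (≡.subst (InRange _ _) j≡ inR)
      d⊞I₁ : ∀ t → lookup (d ⊞ I₁) t ≡ lookup exponents t
      d⊞I₁ t = begin
        lookup (d ⊞ I₁) t                                     ≡⟨ lookup-⊞ d I₁ t ⟩
        lookup d t ℕ.+ lookup I₁ t
          ≡⟨ ≡.cong (ℕ._+ lookup I₁ t) (Vecₚ.lookup-zipWith _∸_ t exponents I₁) ⟩
        (lookup exponents t ∸ lookup I₁ t) ℕ.+ lookup I₁ t   ≡⟨ ℕ.m∸n+n≡m (I₁≤ t) ⟩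
        lookup exponents t                                    ∎
        where open ≡.≡-Reasoning
      q⊛tailX : IsTerm (q ⊛ tailX h₁) 1# (xMon exponents)
      q⊛tailX = isTerm-resp (q ⊛ tailX h₁) (*-identityˡ 1#)
                  (≡.trans (mulMon-xMon d I₁) (≡.cong xMon (≗⇒≡ d⊞I₁)))
                  (isTerm-⊛ q (tailX h₁) (isTerm-singleton _ _) (isTerm-Πx R₁))

    exponent-gap : ¬ (tailX h₁ ∣P monoL l) → ∃[ t ] h₁ ≤ suc (toℕ t) × l (opposite t) ≡ 0
    exponent-gap nd
      with Finₚ.¬∀⟶∃¬ N _ (λ t → (h₁ ≤? suc (toℕ t)) →-dec (1 ≤? l (opposite t))) (nd ∘ monoL-divisible)
    ... | t , ¬covered = t , gap ¬covered
      where
      gap : ¬ (h₁ ≤ suc (toℕ t) → 1 ≤ l (opposite t)) → h₁ ≤ suc (toℕ t) × l (opposite t) ≡ 0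
      gap ¬covered with h₁ ≤? suc (toℕ t) | l (opposite t)
      ... | no  h₁≰ | _     = ⊥-elim (¬covered (⊥-elim ∘ h₁≰))
      ... | yes h₁≤ | zero  = h₁≤ , ≡.refl
      ... | yes h₁≤ | suc _ = ⊥-elim (¬covered λ _ → s≤s z≤n)

module Independence {c ℓ} (K : CommutativeRing c ℓ) {N h₁ : ℕ} (1≤h₁ : 1 ≤ h₁) (h₁≤n : h₁ ≤ suc N) (1≤N : 1 ≤ N)
                    (l : Fin N → ℕ) (l≤ : ∀ j → l j ≤ N ∸ suc (toℕ j))
                    (t₀ : Fin N) (h₁≤t₀ : h₁ ≤ suc (toℕ t₀)) (l-t₀ : l (opposite t₀) ≡ 0) where
  open CommutativeRing K hiding (zero)
  open import Algebra.Properties.CommutativeSemigroup *-commutativeSemigroup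
    using () renaming (interchange to *-interchange)
  open Poly K (suc N)
  open LinearExtension K (suc N)
  open Terms K (suc N)
  open Ranges K (suc N)
  open Sums +-commutativeMonoid
  open Vandermonde K
  open Alternating K
  open Monomial K N l
  open SeparatingFunctional K 1≤h₁ h₁≤n 1≤N

  α′ : Vec ℕ N
  α′ = tabulate (l ∘ opposite)

  open Cycle (toℕ t₀)

  -- A permutation of (0, …, N-1) dominating the exponents of x^L · x₂ ⋯ x_{h₁}: entries below t₀
  -- move up by one, which the gap at t₀ makes room for.
  target : Vec ℕ N
  target = tabulate (cycle ∘ toℕ)

  target-↭ : toList target ↭ upTo N
  target-↭ = ≡.subst (λ m → toList (tabulate {n = m} (cycle ∘ toℕ)) ↭ upTo m) N≡
               (≡.subst (_↭ upTo M) (≡.sym (toList-tabulate-toℕ cycle M)) (applyUpTo-cycle-↭ (N ∸ suc (toℕ t₀))))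
    where
    M = suc (toℕ t₀) ℕ.+ (N ∸ suc (toℕ t₀))
    N≡ : M ≡ N
    N≡ = ℕ.m+[n∸m]≡n (Finₚ.toℕ<n t₀)

  p⃗-≤1 : ∀ s → lookup p⃗ s ≤ 1
  p⃗-≤1 s = ≡.subst (_≤ 1) (≡.sym (lookup-tail (indicator R₀) s))
                    (lookup-indicator-≤1 (range-unique 2 h₁) (Fin.suc s))

  p⃗-above : ∀ s → h₁ ≤ suc (toℕ s) → lookup p⃗ s ≡ 0
  p⃗-above s h₁≤ = ≡.trans (lookup-tail (indicator R₀) s)
                    (lookup-indicator-∉ R₀ (All.map (λ { (_ , ≤h₁) ≡.refl → ℕ.<-irrefl ≡.refl (ℕ.≤-trans ≤h₁ h₁≤) })
                                                    (range-inRange 2 h₁)))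

  target-bound : ∀ s → lookup (α′ ⊞ p⃗) s ≤ lookup target s
  target-bound s = ≡.subst₂ _≤_ (≡.sym (lookup-⊞ α′ p⃗ s)) (≡.sym (Vecₚ.lookup∘tabulate (cycle ∘ toℕ) s))
                     (bound (ℕ.<-cmp (toℕ s) (toℕ t₀)))
    where
    α′≡ : lookup α′ s ≡ l (opposite s)
    α′≡ = Vecₚ.lookup∘tabulate (l ∘ opposite) s
    α′≤ : lookup α′ s ≤ toℕ s
    α′≤ = ≡.subst (_≤ toℕ s) (≡.sym α′≡) (exponent-≤ l≤ s)
    bound : Tri (toℕ s < toℕ t₀) (toℕ s ≡ toℕ t₀) (toℕ t₀ < toℕ s) → lookup α′ s ℕ.+ lookup p⃗ s ≤ cycle (toℕ s)
    bound (tri< s<t₀ _ _) = ≡.subst (lookup α′ s ℕ.+ lookup p⃗ s ≤_) (≡.sym (cycle-< s<t₀))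
                              (ℕ.≤-trans (ℕ.+-mono-≤ α′≤ (p⃗-≤1 s)) (ℕ.≤-reflexive (ℕ.+-comm (toℕ s) 1)))
    bound (tri≈ _ s≡t₀ _) = ℕ.≤-trans (ℕ.≤-reflexive (≡.cong₂ ℕ._+_ α′≡0 p⃗≡0)) z≤n
      where
      α′≡0 = ≡.trans α′≡ (≡.trans (≡.cong (l ∘ opposite) (Finₚ.toℕ-injective s≡t₀)) l-t₀)
      p⃗≡0 = p⃗-above s (≡.subst (λ t → h₁ ≤ suc t) (≡.sym s≡t₀) h₁≤t₀)
    bound (tri> _ _ t₀<s) = ≡.subst (lookup α′ s ℕ.+ lookup p⃗ s ≤_) (≡.sym (cycle-> t₀<s))
                              (ℕ.≤-trans (ℕ.≤-reflexive (≡.trans (≡.cong (lookup α′ s ℕ.+_) (p⃗-above s h₁≤s))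
                                                                 (ℕ.+-identityʳ _)))
                                         α′≤)
      where h₁≤s = ℕ.≤-trans h₁≤t₀ (ℕ.<⇒≤ (s≤s t₀<s))

  g : Vec ℕ N
  g = Vec.zipWith _∸_ target (α′ ⊞ p⃗)

  α′⊞offset₁ : α′ ⊞ offset g 1 ≡ target
  α′⊞offset₁ = ≡.trans (≡.sym (⊞-assoc α′ p⃗ g)) (≗⇒≡ λ s → begin
    lookup (α′ ⊞ p⃗ ⊞ g) s                  ≡⟨ lookup-⊞ (α′ ⊞ p⃗) g s ⟩
    lookup (α′ ⊞ p⃗) s ℕ.+ lookup g s
      ≡⟨ ≡.cong (lookup (α′ ⊞ p⃗) s ℕ.+_) (Vecₚ.lookup-zipWith _∸_ s target (α′ ⊞ p⃗)) ⟩
    lookup (α′ ⊞ p⃗) s ℕ.+ (lookup target s ∸ lookup (α′ ⊞ p⃗) s) ≡⟨ ℕ.m+[n∸m]≡n (target-bound s) ⟩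
    lookup target s                         ∎)
    where open ≡.≡-Reasoning

  weight-unit : ∀ k → weight k 0 (unit k) ≈ σ
  weight-unit k rewrite sum-unit k | lookup-unit-≡ k =
    trans (*-congʳ (*-identityˡ 1#)) (trans (*-identityˡ _) (*-identityʳ σ))

  value : Carrier
  value = σ * vandermonde N (toList target)

  Φ-exponents : ∀ k → Φ k g (exponents , unit k) ≈ value
  Φ-exponents k = trans (reflexive (Φ-eval k g 0 α′ (unit k) (lookup-unit-≡ k)))
                        (*-cong (weight-unit k) (reflexive (≡.cong (vandermonde N ∘ toList) α′⊞offset₁)))

  value-square : value * value ≈ 1#
  value-square with vandermonde-↭upTo N (toList target) target-↭
  ... | j , D≈sign = begin
    σ * D * (σ * D)  ≈⟨ *-interchange σ D σ D ⟩
    σ * σ * (D * D)  ≈⟨ *-cong (sign-square (length R₀)) (trans (*-cong D≈sign D≈sign) (sign-square j)) ⟩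
    1# * 1#          ≈⟨ *-identityˡ 1# ⟩
    1#               ∎
    where
    D = vandermonde N (toList target)
    open import Relation.Binary.Reasoning.Setoid setoid

  extend-linComb : ∀ a k → extend (Φ k g) (linComb a (λ k′ → monoL l ⊛ y k′)) ≈ a k * value
  extend-linComb a k = begin
    extend F (ΣP (map T (allFin (suc N))))   ≈⟨ extend-ΣP F (map T (allFin (suc N))) ⟩
    ∑ (extend F) (map T (allFin (suc N)))     ≡⟨ ∑-map (extend F) T (allFin (suc N)) ⟩
    ∑ (extend F ∘ T) (allFin (suc N))         ≈⟨ ∑-allFin-single _ k off ⟩
    extend F (T k)                             ≈⟨ term k ⟩
    a k * (1# * 1#) * F (exponents , unit k)  ≈⟨ *-cong (*-congˡ (*-identityˡ 1#)) (Φ-exponents k) ⟩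
    a k * 1# * value                           ≈⟨ *-congʳ (*-identityʳ (a k)) ⟩
    a k * value                                ∎
    where
    open import Relation.Binary.Reasoning.Setoid setoid
    F = Φ k g
    T : Fin (suc N) → P
    T k′ = const (a k′) ⊛ (monoL l ⊛ y k′)
    off : ∀ k′ → k′ ≢ k → extend F (T k′) ≈ 0#
    term : ∀ k′ → extend F (T k′) ≈ a k′ * (1# * 1#) * F (exponents , unit k′)
    term k′ = isTerm-resp (T k′) refl (≡.trans (mulMon-identityˡ _) (mulMon-xMon-yMon exponents (unit k′)))
                (isTerm-⊛ (const (a k′)) (monoL l ⊛ y k′) (isTerm-singleton _ _)
                          (isTerm-⊛ (monoL l) (y k′) isTerm-monoL (isTerm-singleton _ _))) F
    off k′ k′≢k = trans (term k′) (trans (*-congˡ (Φ-y-off k g exponents k′≢k)) (zeroʳ _))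

  linearlyIndependent : LinIndepInR h₁ (λ k → monoL l ⊛ y k)
  linearlyIndependent a inI k = begin
    a k                    ≈⟨ *-identityʳ (a k) ⟨
    a k * 1#               ≈⟨ *-congˡ value-square ⟨
    a k * (value * value)  ≈⟨ *-assoc (a k) value value ⟨
    a k * value * value    ≈⟨ *-congʳ (trans (sym (extend-linComb a k)) (Φ-kills-I k g {f} inI)) ⟩
    0# * value             ≈⟨ zeroˡ value ⟩
    0#                     ∎
    where
    open import Relation.Binary.Reasoning.Setoid setoid
    f = linComb a (λ k′ → monoL l ⊛ y k′)

mainTheorem9 : ∀ {c ℓ} (K : CommutativeRing c ℓ) → IsField K → CharZero K → AlgClosed K →
    (n h₁ : ℕ) → 2 ≤ n → 1 ≤ h₁ → h₁ ≤ n →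
    (l : Fin (n ∸ 1) → ℕ) → (∀ j → l j ≤ n ∸ 1 ∸ suc (toℕ j)) →
    ¬ (Poly._∣P_ K n (Poly.tailX K n h₁) (Poly.monoL K n l)) →
    Poly.LinIndepInR K n h₁ (λ k → Poly._⊛_ K n (Poly.monoL K n l) (Poly.y K n k))
mainTheorem9 K _ _ _ (suc (suc N)) h₁ (s≤s (s≤s z≤n)) 1≤h₁ h₁≤n l l≤ nd
  with Monomial.exponent-gap K (suc N) l 1≤h₁ nd
... | t₀ , h₁≤t₀ , l-t₀ = Independence.linearlyIndependent K 1≤h₁ h₁≤n (s≤s z≤n) l l≤ t₀ h₁≤t₀ l-t₀
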